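{- Let $p$ be an odd prime, $q$ a power of $p$, and $n,k$ positive integers. Then: (1) For every $y$ in an extension field of $\mathbb{F}_p$ with $y\neq \frac12$, $F_n(1,y(1-y))=\dfrac{y^n-(1-y)^n}{2y-1}$. Moreover $F_n(1,\frac14)=\dfrac{n}{2^{n-1}}$ (computed in $\mathbb{F}_p$). (2) If $\gcd(n,k)=1$, then $F_{np^k}(1,x)=\bigl(F_n(1,x)\bigr)^{p^k}(1-4x)^{\frac{p^k-1}{2}}$ in $\mathbb{F}_q[x]$. (3) If $n_1,n_2$ are positive integers with $n_1\equiv n_2 \pmod{q^2-1}$, then $F_{n_1}(1,x_0)=F_{n_2}(1,x_0)$ for every $x_0\in\mathbb{F}_q\setminus\{\frac14\}$.
   Context: For an integer $n\ge 1$, the $n$-th reversed Dickson polynomial of the third kind is $F_n(a,x)=\sum_{i=0}^{\lfloor n/2\rfloor}\frac{n-2i}{n-i}\binom{n-i}{i}(-x)^i a^{n-2i}$, where the coefficients $\frac{n-2i}{n-i}\binom{n-i}{i}=\binom{n-i}{i}-\binom{n-i-1}{i-1}$ (with $\binom{m}{ -1}=0$) are integers, read in $\mathbb{F}_q$. Here $\frac12,\frac14$ denote the inverses of $2,4$ in $\mathbb{F}_p$. -}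

module Defs where

open import Level using (Level; _⊔_) renaming (suc to lsuc)
open import Data.Nat using (ℕ; zero; suc; _∸_; _/_)
open import Data.Nat.Combinatorics using (_C_)
open import Data.Integer using (ℤ; +_; -[1+_]) renaming (_-_ to _-ℤ_)
open import Data.List using (List; []; _∷_; map; upTo; foldr)
open import Data.Fin using (Fin)
open import Data.Product using (∃)
open import Relation.Nullary using (¬_)
import Relation.Binary.PropositionalEquality
open import Algebra.Bundles using (CommutativeRing)
open import Algebra.Bundles.Raw using (RawRing)

module RawOps {c ℓ} (R : RawRing c ℓ) where
  open RawRing R

  infixr 8 _^_
  _^_ : Carrier → ℕ → Carrier
  x ^ zero  = 1#
  x ^ suc n = x * (x ^ n)

  _-_ : Carrier → Carrier → Carrier
  x - y = x + (- y)

  fromℕ : ℕ → Carrier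
  fromℕ zero    = 0#
  fromℕ (suc n) = 1# + fromℕ n

  fromℤ : ℤ → Carrier
  fromℤ (+ n)      = fromℕ n
  fromℤ -[1+ n ]   = - fromℕ (suc n)

  sumL : List Carrier → Carrier
  sumL = foldr _+_ 0#

  -- integer coefficient  binom(n-i,i) - binom(n-i-1,i-1)   (binom(m,-1) = 0)
  -- which equals (n-2i)/(n-i) * binom(n-i,i)
  dcoeff : ℕ → ℕ → ℤ
  dcoeff n zero    = + ((n ∸ zero) C zero)
  dcoeff n (suc j) = (+ ((n ∸ suc j) C suc j)) -ℤ (+ ((n ∸ suc j ∸ 1) C j))

  -- n-th reversed Dickson polynomial of the third kind, evaluated at (a , x):
  -- F_n(a,x) = Σ_{i=0}^{⌊n/2⌋} dcoeff n i · (-x)^i · a^(n-2i)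
  F : ℕ → Carrier → Carrier → Carrier
  F n a x = sumL (map (λ i → fromℤ (dcoeff n i) * (((- x) ^ i) * (a ^ (n ∸ (i Data.Nat.+ i)))))
                      (upTo (suc (n / 2))))

-- Polynomials in one variable over a raw ring: coefficient lists
-- (constant term first), equality = equality of all coefficients.

module Poly {c ℓ} (R : RawRing c ℓ) where
  open RawRing R

  coeff : List Carrier → ℕ → Carrier
  coeff []       _       = 0#
  coeff (a ∷ _)  zero    = a
  coeff (_ ∷ as) (suc i) = coeff as i

  addP : List Carrier → List Carrier → List Carrier
  addP []       qs       = qs
  addP (p ∷ ps) []       = p ∷ ps
  addP (p ∷ ps) (q ∷ qs) = (p + q) ∷ addP ps qs

  mulP : List Carrier → List Carrier → List Carrier
  mulP []       qs = []
  mulP (p ∷ ps) qs = addP (map (p *_) qs) (0# ∷ mulP ps qs)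

  _≈P_ : List Carrier → List Carrier → Set ℓ
  ps ≈P qs = ∀ i → coeff ps i ≈ coeff qs i

  polyRawRing : RawRing c ℓ
  polyRawRing = record
    { Carrier = List Carrier
    ; _≈_ = _≈P_
    ; _+_ = addP
    ; _*_ = mulP
    ; -_  = map (-_)
    ; 0#  = []
    ; 1#  = 1# ∷ []
    }

  X : List Carrier
  X = 0# ∷ 1# ∷ []

  const : Carrier → List Carrier
  const a = a ∷ []

record Field c ℓ : Set (lsuc (c ⊔ ℓ)) where
  field
    commutativeRing : CommutativeRing c ℓ
  open CommutativeRing commutativeRing
  field
    inv      : Carrier → Carrier
    inv-cong : ∀ {x y} → x ≈ y → inv x ≈ inv y
    0≉1      : ¬ (0# ≈ 1#)
    inverseʳ : ∀ x → ¬ (x ≈ 0#) → x * inv x ≈ 1#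
    inv-0    : inv 0# ≈ 0#
  open CommutativeRing commutativeRing public

module _ {c ℓ} (K : Field c ℓ) where
  open Field K
  open RawOps rawRing

  -- p · 1 = 0 in K; for p prime (as in all uses) this says char K = p
  HasCharacteristic : ℕ → Set ℓ
  HasCharacteristic p = fromℕ p ≈ 0#

  record HasCardinality (q : ℕ) : Set (c ⊔ ℓ) where
    field
      enum       : Fin q → Carrier
      enum-inj   : ∀ i j → enum i ≈ enum j → i Relation.Binary.PropositionalEquality.≡ j
      enum-surj  : ∀ x → ∃ λ i → enum i ≈ x

open import Level using (0ℓ)
open import Data.Nat using (_≤_) renaming (_*_ to _*ℕ_; _^_ to _^ℕ_)
open import Data.Integer using () renaming (_-_ to _-z_)
open import Data.Integer.Divisibility using () renaming (_∣_ to _∣ℤ_)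
open import Data.Product using (_×_)

-- (1) For every extension field K of F_p (i.e. every field of characteristic p):
--   F_n(1, y(1-y)) = (y^n - (1-y)^n)/(2y-1) for y ≠ 1/2, and F_n(1,1/4) = n/2^(n-1).
Claim1In : Field 0ℓ 0ℓ → ℕ → Set
Claim1In K n =
  ((y : Carrier) → ¬ (y ≈ half) →
     F n 1# (y * (1# - y)) ≈ ((y ^ n) - ((1# - y) ^ n)) * inv ((two * y) - 1#))
  × (F n 1# (inv (fromℕ 4)) ≈ fromℕ n * inv (two ^ (n ∸ 1)))
  where
  open Field K using (Carrier; _≈_; _*_; 1#; inv; rawRing)
  open RawOps rawRing
  two  = fromℕ 2
  half = inv two

Claim1 : ℕ → ℕ → Set₁
Claim1 p n = (K : Field 0ℓ 0ℓ) → HasCharacteristic K p → Claim1In K n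

Claim2 : ℕ → ℕ → ℕ → Field 0ℓ 0ℓ → Set
Claim2 p n k Fq =
  F (n *ℕ p ^ℕ k) (const 1#) X
    ≈P mulP (F n (const 1#) X ^P (p ^ℕ k))
            ((const 1# -P mulP (const (fromℕK 4)) X) ^P ((p ^ℕ k ∸ 1) / 2))
  where
  open Field Fq using (rawRing; 1#)
  open Poly rawRing
  open RawOps polyRawRing renaming (_^_ to _^P_; _-_ to _-P_)
  fromℕK = RawOps.fromℕ rawRing

Claim3 : ℕ → Field 0ℓ 0ℓ → Set
Claim3 q Fq = (n₁ n₂ : ℕ) → 1 ≤ n₁ → 1 ≤ n₂ →
  (+ (q ^ℕ 2 ∸ 1)) ∣ℤ ((+ n₁) -z (+ n₂)) →
  (x₀ : Carrier) → ¬ (x₀ ≈ inv (RawOps.fromℕ rawRing 4)) →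
  RawOps.F rawRing n₁ 1# x₀ ≈ RawOps.F rawRing n₂ 1# x₀
  where open Field Fq

module Submission where

-- F_n(1, x) is the n-th term U_n of the Lucas sequence of the
-- quadratic T² - T + x (U₀ = 0, U₁ = 1, U_{n+2} = U_{n+1} - x·U_n): the
-- coefficient (n-2i)/(n-i)·C(n-i,i) = C(n-i,i) - C(n-i-1,i-1) splits F_n into
-- U_{n+1} + x·U_{n-1}, where U_{m+1} = Σ_i C(m-i,i)(-x)^i by Pascal's rule.
-- For x = y(1-y) the roots are y, 1-y and (2y - 1)·U_n = y^n - (1-y)^n.
--  (1) is this closed form in a field, together with U_n(1/4) = n/2^(n-1).
--  (2), (3) work in Q = S[t]/(t² - t + x), where t, 1-t are the roots and
--      δ = 2t - 1 has δ² = 1 - 4x, so δ·U_n = t^n - (1-t)^n and δ cancels.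
--  (2) In characteristic p, u ↦ u^(p^k) is additive, which gives
--      U_{np^k} = (1-4x)^((p^k-1)/2)·U_n^(p^k) in every ring of characteristic p;
--      we apply it in F_q[x].
--  (3) Over F_q with 1 - 4x₀ ≠ 0, u ↦ u^q fixes F_q (Fermat) and maps t to a
--      root, i.e. to t or 1-t; so t and 1-t are fixed by u ↦ u^(q²), and
--      U_n(x₀) is periodic in n with period q² - 1.
-- The file develops, in order: arithmetic facts, ring facts, finite sums, the
-- Lucas sequence, field facts and part (1), the Frobenius map, the polynomial
-- ring, the quadratic algebra, part (2), Fermat's little theorem, the
-- Frobenius of the root, part (3), and finally the theorem.

open import Defs
open import Algebra.Bundles using (CommutativeRing)
open import Data.Nat using (ℕ; suc; _%_)
open import Data.Nat.Primality using (Prime)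
open import Relation.Nullary using (¬_)
open import Relation.Binary.PropositionalEquality using (_≡_)


module NatFacts where
  open import Data.Nat
  open import Data.Nat.Properties
  open import Data.Nat.DivMod
  open import Relation.Binary.PropositionalEquality

  private
    double : ∀ h → h * 2 ≡ h + h
    double h = trans (*-comm h 2) (cong (h +_) (+-identityʳ h))

  half-bound : ∀ m → m ≤ suc (m / 2 + m / 2)
  half-bound m = begin
    m                      ≡⟨ m≡m%n+[m/n]*n m 2 ⟩
    m % 2 + m / 2 * 2      ≤⟨ +-mono-≤ (≤-pred (m%n<n m 2)) (≤-reflexive (double (m / 2))) ⟩
    suc (m / 2 + m / 2)    ∎
    where open ≤-Reasoning

  -- The range i ≤ ⌊m/2⌋ of F_m contains every i with 2i ≤ m ...
  half-range : ∀ m → m < suc (m / 2) + suc (m / 2)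
  half-range m = s≤s (subst (m ≤_) (sym (+-suc (m / 2) (m / 2))) (half-bound m))

  -- ... and the range 1 ≤ i ≤ ⌊(k+2)/2⌋, shifted down by one, contains
  -- every i with 2i ≤ k.
  half-range₂ : ∀ k → k < suc (suc k) / 2 + suc (suc k) / 2
  half-range₂ k = ≤-pred (half-bound (suc (suc k)))

  double-above : ∀ {m B} → m < B → m < B + B
  double-above {m} {B} m<B = <-≤-trans m<B (m≤m+n B B)

  odd-pow : ∀ p → p % 2 ≡ 1 → ∀ k → p ^ k % 2 ≡ 1
  odd-pow p p-odd zero    = refl
  odd-pow p p-odd (suc k) = begin-equality
    p * p ^ k % 2                 ≡⟨ %-distribˡ-* p (p ^ k) 2 ⟩
    (p % 2) * (p ^ k % 2) % 2     ≡⟨ cong₂ (λ a b → a * b % 2) p-odd (odd-pow p p-odd k) ⟩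
    1                             ∎
    where open ≤-Reasoning

  odd-form : ∀ n → n % 2 ≡ 1 → n ≡ suc (n / 2 * 2)
  odd-form n n-odd = trans (m≡m%n+[m/n]*n n 2) (cong (_+ n / 2 * 2) n-odd)


-- Basic facts about an arbitrary commutative ring: the canonical maps
-- from ℕ and ℤ are homomorphisms (which lets us run the ring solver
-- with integer coefficients), and the laws of natural powers.
-- The difference x - y = x + - y of Defs.RawOps has no fixity declaration,
-- so differences are always written in parentheses.
module RingFacts {c ℓ} (R : CommutativeRing c ℓ) where
  open import Data.Maybe using (Maybe; just; nothing)
  open import Data.Nat as ℕ using (ℕ; zero; suc)
  import Data.Nat.Properties as ℕP
  open import Data.Integer as ℤ using (ℤ; +_; -[1+_]; _⊖_)
  import Data.Integer.Properties as ℤP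
  import Data.Sign as Sign
  open import Relation.Nullary using (yes; no)
  open import Relation.Binary.PropositionalEquality as P using (_≡_)
  import Algebra.Solver.Ring.AlmostCommutativeRing as ACR
  import Algebra.Solver.Ring

  open CommutativeRing R hiding (_-_) public
  open RawOps rawRing public
  open import Algebra.Properties.Ring ring public
    using (-‿distribˡ-*; -‿distribʳ-*; -‿involutive; -0#≈0#; -‿+-comm)
  open import Relation.Binary.Reasoning.Setoid setoid

  fromℕ-+ : ∀ m n → fromℕ (m ℕ.+ n) ≈ fromℕ m + fromℕ n
  fromℕ-+ zero    n = sym (+-identityˡ _)
  fromℕ-+ (suc m) n = trans (+-congˡ (fromℕ-+ m n)) (sym (+-assoc _ _ _))

  fromℕ-* : ∀ m n → fromℕ (m ℕ.* n) ≈ fromℕ m * fromℕ n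
  fromℕ-* zero    n = sym (zeroˡ _)
  fromℕ-* (suc m) n = begin
    fromℕ (n ℕ.+ m ℕ.* n)             ≈⟨ fromℕ-+ n (m ℕ.* n) ⟩
    fromℕ n + fromℕ (m ℕ.* n)         ≈⟨ +-cong (sym (*-identityˡ _)) (fromℕ-* m n) ⟩
    1# * fromℕ n + fromℕ m * fromℕ n  ≈⟨ sym (distribʳ _ _ _) ⟩
    (1# + fromℕ m) * fromℕ n          ∎

  fromℕ-cong : ∀ {m n} → m ≡ n → fromℕ m ≈ fromℕ n
  fromℕ-cong P.refl = refl

  private
    cancel-1# : ∀ a b → (1# + a) + - (1# + b) ≈ a + - b
    cancel-1# a b = begin
      (1# + a) + - (1# + b)    ≈⟨ +-congˡ (sym (-‿+-comm 1# b)) ⟩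
      (1# + a) + (- 1# + - b)  ≈⟨ +-assoc _ _ _ ⟩
      1# + (a + (- 1# + - b))  ≈⟨ +-congˡ (sym (+-assoc _ _ _)) ⟩
      1# + ((a + - 1#) + - b)  ≈⟨ +-congˡ (+-congʳ (+-comm _ _)) ⟩
      1# + ((- 1# + a) + - b)  ≈⟨ +-congˡ (+-assoc _ _ _) ⟩
      1# + (- 1# + (a + - b))  ≈⟨ sym (+-assoc _ _ _) ⟩
      (1# + - 1#) + (a + - b)  ≈⟨ +-congʳ (-‿inverseʳ 1#) ⟩
      0# + (a + - b)           ≈⟨ +-identityˡ _ ⟩
      a + - b                  ∎

    fromℤ-◃⁺ : ∀ k → fromℤ (Sign.+ ℤ.◃ k) ≈ fromℕ k
    fromℤ-◃⁺ zero    = refl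
    fromℤ-◃⁺ (suc k) = refl

    fromℤ-◃⁻ : ∀ k → fromℤ (Sign.- ℤ.◃ k) ≈ - fromℕ k
    fromℤ-◃⁻ zero    = sym -0#≈0#
    fromℤ-◃⁻ (suc k) = refl

  fromℤ-⊖ : ∀ m n → fromℤ (m ⊖ n) ≈ fromℕ m + - fromℕ n
  fromℤ-⊖ m zero = begin
    fromℤ (m ⊖ 0)   ≡⟨ P.cong fromℤ (ℤP.⊖-≥ {m} {0} ℕ.z≤n) ⟩
    fromℕ m         ≈⟨ sym (+-identityʳ _) ⟩
    fromℕ m + 0#    ≈⟨ +-congˡ (sym -0#≈0#) ⟩
    fromℕ m + - 0#  ∎
  fromℤ-⊖ zero (suc n) = begin
    fromℤ (0 ⊖ suc n)     ≡⟨ P.cong fromℤ (ℤP.⊖-< {0} {suc n} (ℕ.s≤s ℕ.z≤n)) ⟩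
    - fromℕ (suc n)       ≈⟨ sym (+-identityˡ _) ⟩
    0# + - fromℕ (suc n)  ∎
  fromℤ-⊖ (suc m) (suc n) = begin
    fromℤ (suc m ⊖ suc n)            ≡⟨ P.cong fromℤ (ℤP.[1+m]⊖[1+n]≡m⊖n m n) ⟩
    fromℤ (m ⊖ n)                    ≈⟨ fromℤ-⊖ m n ⟩
    fromℕ m + - fromℕ n              ≈⟨ sym (cancel-1# _ _) ⟩
    fromℕ (suc m) + - fromℕ (suc n)  ∎

  fromℤ-neg : ∀ i → fromℤ (ℤ.- i) ≈ - fromℤ i
  fromℤ-neg (+ zero)  = sym -0#≈0#
  fromℤ-neg (+ suc n) = refl
  fromℤ-neg -[1+ n ]  = sym (-‿involutive _)

  fromℤ-+ : ∀ i j → fromℤ (i ℤ.+ j) ≈ fromℤ i + fromℤ j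
  fromℤ-+ (+ m)    (+ n)    = fromℕ-+ m n
  fromℤ-+ (+ m)    -[1+ n ] = fromℤ-⊖ m (suc n)
  fromℤ-+ -[1+ m ] (+ n)    = trans (fromℤ-⊖ n (suc m)) (+-comm _ _)
  fromℤ-+ -[1+ m ] -[1+ n ] = begin
    - fromℕ (suc (suc (m ℕ.+ n)))      ≈⟨ -‿cong (fromℕ-cong (P.cong suc (P.sym (ℕP.+-suc m n)))) ⟩
    - fromℕ (suc m ℕ.+ suc n)          ≈⟨ -‿cong (fromℕ-+ (suc m) (suc n)) ⟩
    - (fromℕ (suc m) + fromℕ (suc n))  ≈⟨ sym (-‿+-comm _ _) ⟩
    - fromℕ (suc m) + - fromℕ (suc n)  ∎

  fromℤ-* : ∀ i j → fromℤ (i ℤ.* j) ≈ fromℤ i * fromℤ j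
  fromℤ-* (+ m) (+ n) = trans (fromℤ-◃⁺ (m ℕ.* n)) (fromℕ-* m n)
  fromℤ-* (+ m) -[1+ n ] = begin
    fromℤ (Sign.- ℤ.◃ (m ℕ.* suc n))  ≈⟨ fromℤ-◃⁻ (m ℕ.* suc n) ⟩
    - fromℕ (m ℕ.* suc n)             ≈⟨ -‿cong (fromℕ-* m (suc n)) ⟩
    - (fromℕ m * fromℕ (suc n))       ≈⟨ -‿distribʳ-* _ _ ⟩
    fromℕ m * - fromℕ (suc n)         ∎
  fromℤ-* -[1+ m ] (+ n) = begin
    fromℤ (Sign.- ℤ.◃ (suc m ℕ.* n))  ≈⟨ fromℤ-◃⁻ (suc m ℕ.* n) ⟩
    - fromℕ (suc m ℕ.* n)             ≈⟨ -‿cong (fromℕ-* (suc m) n) ⟩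
    - (fromℕ (suc m) * fromℕ n)       ≈⟨ -‿distribˡ-* _ _ ⟩
    - fromℕ (suc m) * fromℕ n         ∎
  fromℤ-* -[1+ m ] -[1+ n ] = begin
    fromℤ (Sign.+ ℤ.◃ (suc m ℕ.* suc n))  ≈⟨ fromℤ-◃⁺ (suc m ℕ.* suc n) ⟩
    fromℕ (suc m ℕ.* suc n)               ≈⟨ fromℕ-* (suc m) (suc n) ⟩
    fromℕ (suc m) * fromℕ (suc n)         ≈⟨ sym (-‿involutive _) ⟩
    - - (fromℕ (suc m) * fromℕ (suc n))   ≈⟨ -‿cong (-‿distribˡ-* _ _) ⟩
    - (- fromℕ (suc m) * fromℕ (suc n))   ≈⟨ -‿distribʳ-* _ _ ⟩
    - fromℕ (suc m) * - fromℕ (suc n)     ∎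

  -- Integer coefficients for the ring solver.  The constant 1 is sent to
  -- 1# itself (rather than to fromℤ (+ 1) = 1# + 0#) so that solver
  -- equations mention 1# literally.
  private
    coefficient : ℤ → Carrier
    coefficient (+ suc zero) = 1#
    coefficient i            = fromℤ i

    coefficient≈fromℤ : ∀ i → coefficient i ≈ fromℤ i
    coefficient≈fromℤ (+ zero)          = refl
    coefficient≈fromℤ (+ suc zero)      = sym (+-identityʳ 1#)
    coefficient≈fromℤ (+ suc (suc n))   = refl
    coefficient≈fromℤ -[1+ n ]          = refl

    lift₂ : ∀ (f : ℤ → ℤ → ℤ) (_∙_ : Carrier → Carrier → Carrier) →
            (∀ {a b c d} → a ≈ b → c ≈ d → (a ∙ c) ≈ (b ∙ d)) →
            (∀ i j → fromℤ (f i j) ≈ fromℤ i ∙ fromℤ j) →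
            ∀ i j → coefficient (f i j) ≈ coefficient i ∙ coefficient j
    lift₂ f _∙_ ∙-cong hom i j = trans (coefficient≈fromℤ (f i j))
      (trans (hom i j) (sym (∙-cong (coefficient≈fromℤ i) (coefficient≈fromℤ j))))

    almostCommutativeRing : ACR.AlmostCommutativeRing c ℓ
    almostCommutativeRing = ACR.fromCommutativeRing R

    coefficient-morphism : ℤ.+-*-rawRing ACR.-Raw-AlmostCommutative⟶ almostCommutativeRing
    coefficient-morphism = record
      { ⟦_⟧    = coefficient
      ; +-homo = lift₂ ℤ._+_ _+_ +-cong fromℤ-+
      ; *-homo = lift₂ ℤ._*_ _*_ *-cong fromℤ-*
      ; -‿homo = λ i → trans (coefficient≈fromℤ (ℤ.- i))
                   (trans (fromℤ-neg i) (sym (-‿cong (coefficient≈fromℤ i))))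
      ; 0-homo = refl
      ; 1-homo = refl
      }

    coefficient-≟ : ∀ a b → Maybe (coefficient a ≈ coefficient b)
    coefficient-≟ a b with a ℤ.≟ b
    ... | yes P.refl = just refl
    ... | no _       = nothing

  module Solver = Algebra.Solver.Ring ℤ.+-*-rawRing almostCommutativeRing
                    coefficient-morphism coefficient-≟

  ^-congˡ : ∀ n {a b} → a ≈ b → a ^ n ≈ b ^ n
  ^-congˡ zero    e = refl
  ^-congˡ (suc n) e = *-cong e (^-congˡ n e)

  ^-+ : ∀ a m n → a ^ (m ℕ.+ n) ≈ a ^ m * a ^ n
  ^-+ a zero    n = sym (*-identityˡ _)
  ^-+ a (suc m) n = trans (*-congˡ (^-+ a m n)) (sym (*-assoc _ _ _))

  ^-distrib-* : ∀ a b n → (a * b) ^ n ≈ a ^ n * b ^ n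
  ^-distrib-* a b zero    = sym (*-identityˡ _)
  ^-distrib-* a b (suc n) = trans (*-congˡ (^-distrib-* a b n))
    (solve 4 (λ A B X Y → (A :* B) :* (X :* Y) := (A :* X) :* (B :* Y)) refl a b (a ^ n) (b ^ n))
    where open Solver using (solve; _:=_; _:*_)

  ^-* : ∀ a m n → a ^ (m ℕ.* n) ≈ (a ^ m) ^ n
  ^-* a m zero    = reflexive (P.cong (a ^_) (ℕP.*-zeroʳ m))
  ^-* a m (suc n) = begin
    a ^ (m ℕ.* suc n)      ≡⟨ P.cong (a ^_) (ℕP.*-suc m n) ⟩
    a ^ (m ℕ.+ m ℕ.* n)    ≈⟨ ^-+ a m (m ℕ.* n) ⟩
    a ^ m * a ^ (m ℕ.* n)  ≈⟨ *-congˡ (^-* a m n) ⟩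
    a ^ m * (a ^ m) ^ n    ∎

  1^ : ∀ n → 1# ^ n ≈ 1#
  1^ zero    = refl
  1^ (suc n) = trans (*-identityˡ _) (1^ n)

  -- u ↦ 1 - u swaps the two roots of T² - T + x
  complement-involutive : ∀ u → 1# - (1# - u) ≈ u
  complement-involutive = solve 1 (λ U → con (+ 1) :+ :- (con (+ 1) :+ :- U) := U) refl
    where open Solver using (solve; _:=_; _:+_; :-_; con)

  ^-of-scaling-square : ∀ v c → v * v ≈ c * v → ∀ j → v ^ suc j ≈ c ^ j * v
  ^-of-scaling-square v c v²≈cv zero    = *-comm v 1#
  ^-of-scaling-square v c v²≈cv (suc j) = begin
    v * v ^ suc j      ≈⟨ *-congˡ (^-of-scaling-square v c v²≈cv j) ⟩
    v * (c ^ j * v)    ≈⟨ solve 3 (λ V C′ W → V :* (C′ :* W) := C′ :* (V :* W)) refl v (c ^ j) v ⟩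
    c ^ j * (v * v)    ≈⟨ *-congˡ v²≈cv ⟩
    c ^ j * (c * v)    ≈⟨ sym (*-assoc _ _ _) ⟩
    (c ^ j * c) * v    ≈⟨ *-congʳ (*-comm _ _) ⟩
    c ^ suc j * v      ∎
    where open Solver using (solve; _:=_; _:*_)

  ^-periodic : ∀ u T → u ^ suc T ≈ u → ∀ n j → u ^ (suc n ℕ.+ j ℕ.* T) ≈ u ^ suc n
  ^-periodic u T u^T+1≈u n zero    = reflexive (P.cong (u ^_) (ℕP.+-identityʳ (suc n)))
  ^-periodic u T u^T+1≈u n (suc j) = begin
    u ^ (suc n ℕ.+ (T ℕ.+ j ℕ.* T))  ≡⟨ P.cong (u ^_) (reorder n (j ℕ.* T)) ⟩
    u ^ (m ℕ.+ suc T)                ≈⟨ ^-+ u m (suc T) ⟩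
    u ^ m * u ^ suc T                ≈⟨ *-congˡ u^T+1≈u ⟩
    u ^ m * u                        ≈⟨ *-comm _ _ ⟩
    u ^ suc m                        ≈⟨ ^-periodic u T u^T+1≈u n j ⟩
    u ^ suc n                        ∎
    where
    m = n ℕ.+ j ℕ.* T
    reorder : ∀ n r → suc n ℕ.+ (T ℕ.+ r) ≡ (n ℕ.+ r) ℕ.+ suc T
    reorder n r = P.trans (P.cong suc (P.trans (P.cong (n ℕ.+_) (ℕP.+-comm T r)) (P.sym (ℕP.+-assoc n r T))))
                          (P.sym (ℕP.+-suc (n ℕ.+ r) T))


module FiniteSums {c ℓ} (R : CommutativeRing c ℓ) where
  open import Data.Nat as ℕ using (ℕ; zero; suc; _≤_; z≤n; s≤s)
  open import Data.List using (map; applyUpTo)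
  open import Function using (_∘_)
  open import Relation.Binary.PropositionalEquality as P using (_≡_)
  open RingFacts R
  open Solver using (solve; _:=_; _:+_)

  sumTo : (ℕ → Carrier) → ℕ → Carrier
  sumTo f zero    = 0#
  sumTo f (suc m) = f 0 + sumTo (f ∘ suc) m

  sumL-applyUpTo : ∀ (g : ℕ → Carrier) h m → sumL (map g (applyUpTo h m)) ≡ sumTo (g ∘ h) m
  sumL-applyUpTo g h zero    = P.refl
  sumL-applyUpTo g h (suc m) = P.cong (g (h 0) +_) (sumL-applyUpTo g (h ∘ suc) m)

  sumTo-cong : ∀ {f g} m → (∀ i → f i ≈ g i) → sumTo f m ≈ sumTo g m
  sumTo-cong zero    e = refl
  sumTo-cong (suc m) e = +-cong (e 0) (sumTo-cong m (e ∘ suc))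

  sumTo-+ : ∀ f g m → sumTo (λ i → f i + g i) m ≈ sumTo f m + sumTo g m
  sumTo-+ f g zero    = sym (+-identityʳ 0#)
  sumTo-+ f g (suc m) = trans (+-congˡ (sumTo-+ (f ∘ suc) (g ∘ suc) m))
    (solve 4 (λ a b c d → (a :+ b) :+ (c :+ d) := (a :+ c) :+ (b :+ d)) refl _ _ _ _)

  sumTo-* : ∀ a f m → sumTo (λ i → a * f i) m ≈ a * sumTo f m
  sumTo-* a f zero    = sym (zeroʳ a)
  sumTo-* a f (suc m) = trans (+-congˡ (sumTo-* a (f ∘ suc) m)) (sym (distribˡ _ _ _))

  sumTo-zero : ∀ f m → (∀ i → f i ≈ 0#) → sumTo f m ≈ 0#
  sumTo-zero f zero    e = refl
  sumTo-zero f (suc m) e = trans (+-cong (e 0) (sumTo-zero (f ∘ suc) m (e ∘ suc))) (+-identityʳ 0#)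

  sumTo-extend : ∀ f {B B'} → B ≤ B' → (∀ i → B ≤ i → f i ≈ 0#) → sumTo f B' ≈ sumTo f B
  sumTo-extend f {zero}  {B'}     z≤n       e = sumTo-zero f B' (λ i → e i z≤n)
  sumTo-extend f {suc B} {suc B'} (s≤s B≤B') e =
    +-congˡ (sumTo-extend (f ∘ suc) B≤B' (λ i B≤i → e (suc i) (s≤s B≤i)))


module DiagonalBinomials where
  open import Data.Nat
  open import Data.Nat.Properties
  open import Data.Nat.Combinatorics using (_C_; k>n⇒nCk≡0; nCk+nC[k+1]≡[n+1]C[k+1])
  open import Data.Sum using (inj₁; inj₂)
  open import Relation.Binary.PropositionalEquality

  diagC : ℕ → ℕ → ℕ
  diagC m i = (m ∸ i) C i

  private
    ∸-below : ∀ m i → m < i + i → m ∸ i < i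
    ∸-below m zero    ()
    ∸-below m (suc i) m<2i with ≤-total (suc i) m
    ... | inj₁ i<m = subst (m ∸ suc i <_) (m+n∸n≡m (suc i) (suc i)) (∸-monoˡ-< m<2i i<m)
    ... | inj₂ m≤i = subst (_< suc i) (sym (m≤n⇒m∸n≡0 m≤i)) z<s

  diagC-vanishes : ∀ {m i} → m < i + i → diagC m i ≡ 0
  diagC-vanishes {m} {i} m<2i = k>n⇒nCk≡0 (∸-below m i m<2i)

  -- For i ≤ m this is Pascal's rule for C(m-i+1, i+1); for i > m all three
  -- coefficients vanish.
  diagC-pascal : ∀ m i → diagC (suc (suc m)) (suc i) ≡ diagC (suc m) (suc i) + diagC m i
  diagC-pascal m i with ≤-<-connex i m
  ... | inj₁ i≤m = begin
    (suc m ∸ i) C suc i               ≡⟨ cong (_C suc i) (+-∸-assoc 1 i≤m) ⟩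
    suc (m ∸ i) C suc i               ≡⟨ nCk+nC[k+1]≡[n+1]C[k+1] (m ∸ i) i ⟨
    (m ∸ i) C i + (m ∸ i) C suc i     ≡⟨ +-comm ((m ∸ i) C i) _ ⟩
    (m ∸ i) C suc i + (m ∸ i) C i     ∎
    where open ≡-Reasoning
  diagC-pascal m (suc j) | inj₂ (s≤s m≤j) = trans (k>n⇒nCk≡0 lhs-small)
    (sym (cong₂ _+_ (k>n⇒nCk≡0 (s≤s (≤-trans sj≤j (n≤1+n j))))
                    (k>n⇒nCk≡0 (s≤s sj≤j))))
    where
    sj≤j : m ∸ suc j ≤ j
    sj≤j = ≤-trans (m∸n≤m m (suc j)) m≤j
    lhs-small : m ∸ j < suc (suc j)
    lhs-small = s≤s (≤-trans (m∸n≤m m j) (≤-trans m≤j (n≤1+n j)))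


module Lucas {c ℓ} (R : CommutativeRing c ℓ) where
  open import Data.Nat as ℕ using (ℕ; zero; suc; _∸_; _/_; _≤_; _<_)
  import Data.Nat.Properties as ℕP
  open import Data.Nat.Combinatorics using (_C_)
  open import Data.Integer as ℤ using (+_)
  import Data.Integer.Properties as ℤP
  open import Data.Sum using (inj₁; inj₂)
  open import Function using (_∘_)
  open import Relation.Binary.PropositionalEquality as P using (_≡_)
  open RingFacts R
  open FiniteSums R
  open NatFacts
  open DiagonalBinomials
  open import Relation.Binary.Reasoning.Setoid setoid
  open Solver using (solve; _:=_; _:+_; _:*_; :-_; con)

  U : Carrier → ℕ → Carrier
  U x zero          = 0#
  U x (suc zero)    = 1#
  U x (suc (suc n)) = U x (suc n) - (x * U x n)

  U-cong : ∀ {x x'} → x ≈ x' → ∀ n → U x n ≈ U x' n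
  U-cong x≈x' zero          = refl
  U-cong x≈x' (suc zero)    = refl
  U-cong x≈x' (suc (suc n)) = +-cong (U-cong x≈x' (suc n)) (-‿cong (*-cong x≈x' (U-cong x≈x' n)))

  -- At x = y(1 - y) the quadratic has the roots y and 1 - y.
  lucas-identity : ∀ y n → ((fromℕ 2 * y) - 1#) * U (y * (1# - y)) n ≈ (y ^ n) - ((1# - y) ^ n)
  lucas-identity y zero = solve 1 (λ Y →
    (con (+ 2) :* Y :+ :- con (+ 1)) :* con (+ 0) := con (+ 1) :+ :- con (+ 1)) refl y
  lucas-identity y (suc zero) = solve 1 (λ Y →
    (con (+ 2) :* Y :+ :- con (+ 1)) :* con (+ 1) := Y :* con (+ 1) :+ :- ((con (+ 1) :+ :- Y) :* con (+ 1))) refl y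
  lucas-identity y (suc (suc n)) = begin
    d * (U x (suc n) - (x * U x n))                     ≈⟨ solve 4 (λ D u₁ u₀ X →
                                                            D :* (u₁ :+ :- (X :* u₀)) := D :* u₁ :+ :- (X :* (D :* u₀)))
                                                            refl d (U x (suc n)) (U x n) x ⟩
    (d * U x (suc n)) - (x * (d * U x n))               ≈⟨ +-cong (lucas-identity y (suc n))
                                                            (-‿cong (*-congˡ (lucas-identity y n))) ⟩
    ((y ^ suc n) - (z ^ suc n)) - (x * ((y ^ n) - (z ^ n))) ≈⟨ solve 3 (λ Y a b →
                                                            (Y :* a :+ :- ((con (+ 1) :+ :- Y) :* b))
                                                              :+ :- ((Y :* (con (+ 1) :+ :- Y)) :* (a :+ :- b))
                                                            := Y :* (Y :* a) :+ :- ((con (+ 1) :+ :- Y) :* ((con (+ 1) :+ :- Y) :* b)))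
                                                            refl y (y ^ n) (z ^ n) ⟩
    (y ^ suc (suc n)) - (z ^ suc (suc n))               ∎
    where
    z = 1# - y
    x = y * z
    d = (fromℕ 2 * y) - 1#

  module Expansion (x : Carrier) where
    term : ℕ → ℕ → Carrier
    term m i = fromℕ (diagC m i) * (- x) ^ i

    -- the first B terms of the expansion belonging to U_{m+1}
    expansion : ℕ → ℕ → Carrier
    expansion m B = sumTo (term m) B

    -- All terms with 2i > m vanish, so the sum does not depend on B once 2B > m.
    term-vanishes : ∀ {m B} → m < B ℕ.+ B → ∀ i → B ≤ i → term m i ≈ 0#
    term-vanishes {m} m<2B i B≤i =
      trans (*-congʳ (fromℕ-cong (diagC-vanishes {m} {i} (ℕP.<-≤-trans m<2B (ℕP.+-mono-≤ B≤i B≤i))))) (zeroˡ _)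

    expansion-stable : ∀ m B B' → m < B ℕ.+ B → m < B' ℕ.+ B' → expansion m B ≈ expansion m B'
    expansion-stable m B B' m<2B m<2B' with ℕP.≤-total B B'
    ... | inj₁ B≤B' = sym (sumTo-extend (term m) B≤B' (term-vanishes m<2B))
    ... | inj₂ B'≤B = sumTo-extend (term m) B'≤B (term-vanishes m<2B')

    -- Pascal's rule, termwise, gives the Lucas recurrence for the expansions.
    term-pascal : ∀ m i → term (suc (suc m)) (suc i) ≈ term (suc m) (suc i) + (- x) * term m i
    term-pascal m i = trans (*-congʳ (trans (fromℕ-cong (diagC-pascal m i)) (fromℕ-+ (diagC (suc m) (suc i)) (diagC m i))))
      (solve 4 (λ A B X Y → (A :+ B) :* (:- X :* Y) := A :* (:- X :* Y) :+ :- X :* (B :* Y))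
             refl (fromℕ (diagC (suc m) (suc i))) (fromℕ (diagC m i)) x ((- x) ^ i))

    expansion-step : ∀ m B → expansion (suc (suc m)) (suc B) ≈ expansion (suc m) (suc B) + (- x) * expansion m B
    expansion-step m B = begin
      term (suc (suc m)) 0 + sumTo (term (suc (suc m)) ∘ suc) B
        ≈⟨ +-congˡ (sumTo-cong B (term-pascal m)) ⟩
      term (suc (suc m)) 0 + sumTo (λ i → term (suc m) (suc i) + (- x) * term m i) B
        ≈⟨ +-congˡ (trans (sumTo-+ _ _ B) (+-congˡ (sumTo-* (- x) (term m) B))) ⟩
      term (suc (suc m)) 0 + (sumTo (term (suc m) ∘ suc) B + (- x) * expansion m B)
        ≈⟨ sym (+-assoc _ _ _) ⟩
      expansion (suc m) (suc B) + (- x) * expansion m B ∎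

    expansion≈U : ∀ m → expansion m (suc m) ≈ U x (suc m)
    expansion≈U zero = solve 0 ((con (+ 1) :+ con (+ 0)) :* con (+ 1) :+ con (+ 0) := con (+ 1)) refl
    expansion≈U (suc zero) = solve 1 (λ X →
      (con (+ 1) :+ con (+ 0)) :* con (+ 1) :+ (con (+ 0) :* (:- X :* con (+ 1)) :+ con (+ 0))
        := con (+ 1) :+ :- (X :* con (+ 0))) refl x
    expansion≈U (suc (suc m)) = begin
      expansion (suc (suc m)) (suc (suc (suc m)))
        ≈⟨ expansion-step m (suc (suc m)) ⟩
      expansion (suc m) (suc (suc (suc m))) + (- x) * expansion m (suc (suc m))
        ≈⟨ +-cong (expansion-stable (suc m) (suc (suc (suc m))) (suc (suc m))
                    (double-above (ℕP.m<n⇒m<1+n (ℕP.n<1+n (suc m)))) (double-above (ℕP.n<1+n (suc m))))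
                  (*-congˡ (expansion-stable m (suc (suc m)) (suc m) (double-above (ℕP.m<n⇒m<1+n (ℕP.n<1+n m))) (double-above (ℕP.n<1+n m)))) ⟩
      expansion (suc m) (suc (suc m)) + (- x) * expansion m (suc m)
        ≈⟨ +-cong (expansion≈U (suc m)) (trans (*-congˡ (expansion≈U m)) (sym (-‿distribˡ-* x _))) ⟩
      U x (suc (suc (suc m))) ∎

    dcoeff-split : ∀ m j → fromℤ (dcoeff m (suc j)) ≈ fromℕ (diagC m (suc j)) - fromℕ (diagC (m ∸ 2) j)
    dcoeff-split m j = begin
      fromℤ (dcoeff m (suc j))                         ≡⟨ P.cong fromℤ (ℤP.m-n≡m⊖n (diagC m (suc j)) ((m ∸ suc j ∸ 1) C j)) ⟩
      fromℤ (diagC m (suc j) ℤ.⊖ ((m ∸ suc j ∸ 1) C j)) ≈⟨ fromℤ-⊖ (diagC m (suc j)) ((m ∸ suc j ∸ 1) C j) ⟩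
      fromℕ (diagC m (suc j)) - fromℕ ((m ∸ suc j ∸ 1) C j) ≡⟨ P.cong (λ k → fromℕ (diagC m (suc j)) - fromℕ (k C j)) shift ⟩
      fromℕ (diagC m (suc j)) - fromℕ (diagC (m ∸ 2) j) ∎
      where
      shift : m ∸ suc j ∸ 1 ≡ m ∸ 2 ∸ j
      shift = P.trans (ℕP.∸-+-assoc m (suc j) 1)
        (P.trans (P.cong (m ∸_) (ℕP.+-comm (suc j) 1)) (P.sym (ℕP.∸-+-assoc m 2 j)))

    F-split : ∀ m → F m 1# x ≈ expansion m (suc (m / 2)) + x * expansion (m ∸ 2) (m / 2)
    F-split m = begin
      F m 1# x
        ≡⟨ sumL-applyUpTo (λ i → fromℤ (dcoeff m i) * ((- x) ^ i * 1# ^ (m ∸ (i ℕ.+ i)))) (λ i → i) (suc (m / 2)) ⟩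
      sumTo (λ i → fromℤ (dcoeff m i) * ((- x) ^ i * 1# ^ (m ∸ (i ℕ.+ i)))) (suc (m / 2))
        ≈⟨ sumTo-cong {g = λ i → fromℤ (dcoeff m i) * (- x) ^ i} (suc (m / 2)) (λ i → *-congˡ (trans (*-congˡ (1^ (m ∸ (i ℕ.+ i)))) (*-identityʳ _))) ⟩
      term m 0 + sumTo (λ j → fromℤ (dcoeff m (suc j)) * (- x) ^ suc j) (m / 2)
        ≈⟨ +-congˡ (sumTo-cong (m / 2) (λ j → trans (*-congʳ (dcoeff-split m j))
             (solve 4 (λ A B X Y → (A :+ :- B) :* (:- X :* Y) := A :* (:- X :* Y) :+ X :* (B :* Y))
                    refl (fromℕ (diagC m (suc j))) (fromℕ (diagC (m ∸ 2) j)) x ((- x) ^ j)))) ⟩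
      term m 0 + sumTo (λ j → term m (suc j) + x * term (m ∸ 2) j) (m / 2)
        ≈⟨ +-congˡ (trans (sumTo-+ _ _ (m / 2)) (+-congˡ (sumTo-* x _ (m / 2)))) ⟩
      term m 0 + (sumTo (term m ∘ suc) (m / 2) + x * expansion (m ∸ 2) (m / 2))
        ≈⟨ sym (+-assoc _ _ _) ⟩
      expansion m (suc (m / 2)) + x * expansion (m ∸ 2) (m / 2) ∎

    -- F_{k+2} = U_{k+3} + x·U_{k+1} = U_{k+2}, and F_1 = 1 = U_1.
    F≈U : ∀ n → F (suc n) 1# x ≈ U x (suc n)
    F≈U zero = solve 1 (λ X →
      (con (+ 1) :+ con (+ 0)) :* (con (+ 1) :* (con (+ 1) :* con (+ 1))) :+ con (+ 0) := con (+ 1)) refl x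
    F≈U (suc k) = begin
      F (suc (suc k)) 1# x
        ≈⟨ F-split (suc (suc k)) ⟩
      expansion (suc (suc k)) (suc (suc (suc k) / 2)) + x * expansion k (suc (suc k) / 2)
        ≈⟨ +-cong (expansion-stable _ (suc (suc (suc k) / 2)) (suc (suc (suc k))) (half-range (suc (suc k))) (double-above (ℕP.n<1+n _)))
                  (*-congˡ (expansion-stable k (suc (suc k) / 2) (suc k) (half-range₂ k) (double-above (ℕP.n<1+n k)))) ⟩
      expansion (suc (suc k)) (suc (suc (suc k))) + x * expansion k (suc k)
        ≈⟨ +-cong (expansion≈U (suc (suc k))) (*-congˡ (expansion≈U k)) ⟩
      (U x (suc (suc k)) - (x * U x (suc k))) + x * U x (suc k)
        ≈⟨ solve 3 (λ a b X → (a :+ :- (X :* b)) :+ X :* b := a) refl (U x (suc (suc k))) (U x (suc k)) x ⟩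
      U x (suc (suc k)) ∎


module FieldFacts {c ℓ} (K : Field c ℓ) where
  open import Data.Nat as ℕ using (ℕ; zero; suc; _/_; _%_)
  open import Data.Integer using (+_)
  open import Relation.Nullary using (¬_)
  open import Relation.Binary.PropositionalEquality as P using (_≡_)
  open Field K using (inv; 0≉1; inverseʳ; commutativeRing)
  open RingFacts commutativeRing
  open import Relation.Binary.Reasoning.Setoid setoid
  open Solver using (solve; _:=_; _:+_; _:*_; con)

  -- (Defs.Field provides only the right inverse law)
  inverseˡ : ∀ a → ¬ (a ≈ 0#) → inv a * a ≈ 1#
  inverseˡ a a≉0 = trans (*-comm _ _) (inverseʳ a a≉0)

  cancel-nonzero : ∀ a t → ¬ (a ≈ 0#) → a * t ≈ 0# → t ≈ 0#
  cancel-nonzero a t a≉0 at≈0 = begin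
    t                ≈⟨ sym (*-identityˡ t) ⟩
    1# * t           ≈⟨ *-congʳ (sym (inverseˡ a a≉0)) ⟩
    (inv a * a) * t  ≈⟨ *-assoc _ _ _ ⟩
    inv a * (a * t)  ≈⟨ *-congˡ at≈0 ⟩
    inv a * 0#       ≈⟨ zeroʳ _ ⟩
    0#               ∎

  divide : ∀ a u v → ¬ (a ≈ 0#) → a * u ≈ v → u ≈ v * inv a
  divide a u v a≉0 au≈v = begin
    u                ≈⟨ sym (*-identityʳ u) ⟩
    u * 1#           ≈⟨ *-congˡ (sym (inverseʳ a a≉0)) ⟩
    u * (a * inv a)  ≈⟨ sym (*-assoc _ _ _) ⟩
    (u * a) * inv a  ≈⟨ *-congʳ (trans (*-comm u a) au≈v) ⟩
    v * inv a        ∎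

  mul-nonzero : ∀ a b → ¬ (a ≈ 0#) → ¬ (b ≈ 0#) → ¬ (a * b ≈ 0#)
  mul-nonzero a b a≉0 b≉0 ab≈0 = b≉0 (cancel-nonzero a b a≉0 ab≈0)

  pow-nonzero : ∀ a n → ¬ (a ≈ 0#) → ¬ (a ^ n ≈ 0#)
  pow-nonzero a zero    a≉0 1≈0 = 0≉1 (sym 1≈0)
  pow-nonzero a (suc n) a≉0     = mul-nonzero a (a ^ n) a≉0 (pow-nonzero a n a≉0)

  module OddCharacteristic (p : ℕ) (p-odd : p % 2 ≡ 1) (char : fromℕ p ≈ 0#) where
    -- p = 1 + 2⌊p/2⌋, so 2 = 0 would force 1 = 0.
    two-nonzero : ¬ (fromℕ 2 ≈ 0#)
    two-nonzero 2≈0 = 0≉1 (begin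
      0#                                 ≈⟨ sym char ⟩
      fromℕ p                            ≡⟨ P.cong fromℕ (NatFacts.odd-form p p-odd) ⟩
      fromℕ (1 ℕ.+ p / 2 ℕ.* 2)          ≈⟨ fromℕ-+ 1 (p / 2 ℕ.* 2) ⟩
      fromℕ 1 + fromℕ (p / 2 ℕ.* 2)      ≈⟨ +-congˡ (trans (fromℕ-* (p / 2) 2) (*-congˡ 2≈0)) ⟩
      fromℕ 1 + fromℕ (p / 2) * 0#       ≈⟨ solve 1 (λ a → (con (+ 1) :+ con (+ 0)) :+ a :* con (+ 0) := con (+ 1))
                                              refl (fromℕ (p / 2)) ⟩
      1#                                 ∎)

    four-nonzero : ¬ (fromℕ 4 ≈ 0#)
    four-nonzero 4≈0 = mul-nonzero (fromℕ 2) (fromℕ 2) two-nonzero two-nonzero (trans (sym (fromℕ-* 2 2)) 4≈0)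


module Part1 where
  open import Level using (0ℓ)
  open import Data.Nat as ℕ using (ℕ; zero; suc; _%_; _≤_)
  open import Data.Integer using (+_)
  open import Data.Product using (_,_)
  open import Relation.Nullary using (¬_)
  open import Relation.Binary.PropositionalEquality using (_≡_)

  module InField (K : Field 0ℓ 0ℓ) (p : ℕ) (p-odd : p % 2 ≡ 1) (char : HasCharacteristic K p) where
    open Field K using (inv; inverseʳ; commutativeRing)
    open RingFacts commutativeRing
    open Lucas commutativeRing
    open FieldFacts K
    open OddCharacteristic p p-odd char
    open import Relation.Binary.Reasoning.Setoid setoid
    open Solver using (solve; _:=_; _:+_; _:*_; :-_; con)

    roots-formula : ∀ m y → ¬ (y ≈ inv (fromℕ 2)) →
      F (suc m) 1# (y * (1# - y)) ≈ ((y ^ suc m) - ((1# - y) ^ suc m)) * inv ((fromℕ 2 * y) - 1#)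
    roots-formula m y y≉½ = begin
      F (suc m) 1# (y * (1# - y))  ≈⟨ Expansion.F≈U (y * (1# - y)) m ⟩
      U (y * (1# - y)) (suc m)     ≈⟨ divide d _ _ d≉0 (lucas-identity y (suc m)) ⟩
      ((y ^ suc m) - ((1# - y) ^ suc m)) * inv d ∎
      where
      d = (fromℕ 2 * y) - 1#
      d≉0 : ¬ (d ≈ 0#)
      d≉0 d≈0 = y≉½ (trans (divide (fromℕ 2) y 1# two-nonzero (begin
        fromℕ 2 * y         ≈⟨ solve 1 (λ a → a := (a :+ :- con (+ 1)) :+ con (+ 1)) refl (fromℕ 2 * y) ⟩
        d + 1#              ≈⟨ +-congʳ d≈0 ⟩
        0# + 1#             ≈⟨ +-identityˡ 1# ⟩
        1#                  ∎))
        (*-identityˡ _))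

    quarter : Carrier
    quarter = inv (fromℕ 4)

    four-quarter : fromℕ 4 * quarter ≈ 1#
    four-quarter = inverseʳ (fromℕ 4) four-nonzero

    double-root : ∀ m → fromℕ 2 ^ m * U quarter (suc m) ≈ fromℕ (suc m)
    double-root zero = solve 0 (con (+ 1) :* con (+ 1) := con (+ 1) :+ con (+ 0)) refl
    double-root (suc zero) = solve 1 (λ W →
      (con (+ 2) :* con (+ 1)) :* (con (+ 1) :+ :- (W :* con (+ 0))) := con (+ 1) :+ (con (+ 1) :+ con (+ 0)))
      refl quarter
    double-root (suc (suc m)) = begin
      (fromℕ 2 * (fromℕ 2 * t)) * (U quarter (suc (suc m)) - (quarter * U quarter (suc m)))
        ≈⟨ solve 4 (λ T u₂ u₁ W → (con (+ 2) :* (con (+ 2) :* T)) :* (u₂ :+ :- (W :* u₁))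
                := con (+ 2) :* ((con (+ 2) :* T) :* u₂) :+ :- ((con (+ 4) :* W) :* (T :* u₁)))
                refl t (U quarter (suc (suc m))) (U quarter (suc m)) quarter ⟩
      (fromℕ 2 * ((fromℕ 2 * t) * U quarter (suc (suc m)))) - ((fromℕ 4 * quarter) * (t * U quarter (suc m)))
        ≈⟨ +-cong (*-congˡ (double-root (suc m))) (-‿cong (*-cong four-quarter (double-root m))) ⟩
      (fromℕ 2 * (1# + fromℕ (suc m))) - (1# * fromℕ (suc m))
        ≈⟨ solve 1 (λ N → con (+ 2) :* (con (+ 1) :+ N) :+ :- (con (+ 1) :* N) := con (+ 1) :+ (con (+ 1) :+ N))
                 refl (fromℕ (suc m)) ⟩
      fromℕ (suc (suc (suc m))) ∎
      where t = fromℕ 2 ^ m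

    quarter-formula : ∀ m → F (suc m) 1# quarter ≈ fromℕ (suc m) * inv (fromℕ 2 ^ m)
    quarter-formula m = trans (Expansion.F≈U quarter m)
      (divide (fromℕ 2 ^ m) _ _ (pow-nonzero (fromℕ 2) m two-nonzero) (double-root m))

  part1 : ∀ p n → p % 2 ≡ 1 → 1 ≤ n → Claim1 p n
  part1 p (suc m) p-odd _ K char = roots-formula m , quarter-formula m
    where open InField K p p-odd char


module PrimeBinomial where
  open import Data.Nat
  open import Data.Nat.Properties
  open import Data.Nat.Divisibility using (_∣_; divides; ∣⇒≤; ∣1⇒≡1; m∣m*n)
  open import Data.Nat.DivMod using (m/n*n≡m)
  open import Data.Nat.Primality using (Prime; euclidsLemma; ¬prime[1])
  open import Data.Nat.Combinatorics using (_C_; nCk≡n!/k![n-k]!; k![n∸k]!∣n!)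
  open import Data.Sum using (inj₁; inj₂)
  open import Data.Empty using (⊥-elim)
  open import Relation.Nullary using (¬_)
  open import Relation.Binary.PropositionalEquality

  -- p ∤ m! for m < p, since p divides no factor of m!
  prime∤factorial : ∀ {p} → Prime p → ∀ m → m < p → ¬ (p ∣ m !)
  prime∤factorial p-prime zero    m<p p∣1 with ∣1⇒≡1 p∣1
  ... | refl = ¬prime[1] p-prime
  prime∤factorial p-prime (suc m) m<p p∣m! with euclidsLemma (suc m) (m !) p-prime p∣m!
  ... | inj₁ p∣m = <⇒≱ m<p (∣⇒≤ p∣m)
  ... | inj₂ p∣m! = prime∤factorial p-prime m (<-trans (n<1+n m) m<p) p∣m!

  -- C(p,k)·k!·(p-k)! = p! and p divides neither k! nor (p-k)!.
  prime∣binomial : ∀ {p} → Prime p → ∀ k → 0 < k → k < p → p ∣ (p C k)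
  prime∣binomial {p} p-prime k 0<k k<p with euclidsLemma (p C k) (k ! * (p ∸ k) !) p-prime p∣product
    where
    instance _ = k !* (p ∸ k) !≢0
    product≡p! : (p C k) * (k ! * (p ∸ k) !) ≡ p !
    product≡p! = trans (cong (_* (k ! * (p ∸ k) !)) (nCk≡n!/k![n-k]! (<⇒≤ k<p)))
                       (m/n*n≡m (k![n∸k]!∣n! (<⇒≤ k<p)))
    p∣p! : ∀ p → 0 < p → p ∣ p !
    p∣p! (suc q) _ = m∣m*n (q !)
    p∣product : p ∣ (p C k) * (k ! * (p ∸ k) !)
    p∣product = subst (p ∣_) (sym product≡p!) (p∣p! p (<-trans 0<k k<p))
  ... | inj₁ p∣C = p∣C
  ... | inj₂ p∣k![p-k]! with euclidsLemma (k !) ((p ∸ k) !) p-prime p∣k![p-k]!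
  ...   | inj₁ p∣k! = ⊥-elim (prime∤factorial p-prime k k<p p∣k!)
  ...   | inj₂ p∣[p-k]! = ⊥-elim (prime∤factorial p-prime (p ∸ k) (∸-monoʳ-< 0<k (<⇒≤ k<p)) p∣[p-k]!)


module Frobenius {c ℓ} (R : CommutativeRing c ℓ) where
  open import Data.Nat as ℕ using (ℕ; zero; suc; _∸_; _<_; z≤n; s≤s)
  import Data.Nat.Properties as ℕP
  open import Data.Nat.Divisibility using (divides)
  open import Data.Nat.Primality using (Prime; ¬prime[0]; ¬prime[1])
  open import Data.Nat.Combinatorics using (_C_; nCn≡1)
  open import Data.Fin as Fin using (Fin; toℕ; inject₁)
  import Data.Fin.Properties as FinP
  open import Data.Empty using (⊥-elim)
  open import Data.Integer using (+_)
  open import Relation.Binary.PropositionalEquality as P using (_≡_)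
  open RingFacts R
  open import Relation.Binary.Reasoning.Setoid setoid
  open Solver using (solve; _:=_; _:+_; :-_)
  open import Algebra.Properties.Semiring.Mult semiring using (_×_)
  open import Algebra.Properties.Monoid.Sum +-monoid using (sum)
  import Algebra.Properties.CommutativeSemiring.Binomial commutativeSemiring as Binomial
  open import Algebra.Properties.Semiring.Exp semiring using () renaming (_^_ to _^′_)

  ^′≈^ : ∀ a n → a ^′ n ≈ a ^ n
  ^′≈^ a zero    = refl
  ^′≈^ a (suc n) = *-congˡ (^′≈^ a n)

  ×≈fromℕ* : ∀ n a → n × a ≈ fromℕ n * a
  ×≈fromℕ* zero    a = sym (zeroˡ a)
  ×≈fromℕ* (suc n) a = trans (+-cong (sym (*-identityˡ a)) (×≈fromℕ* n a)) (sym (distribʳ _ _ _))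

  sum-last : ∀ n (s : Fin (suc n) → Carrier) → (∀ (i : Fin n) → s (inject₁ i) ≈ 0#) → sum s ≈ s (Fin.fromℕ n)
  sum-last zero    s vanish = +-identityʳ _
  sum-last (suc n) s vanish = trans (+-cong (vanish Fin.zero) (sum-last n (λ i → s (Fin.suc i)) (λ i → vanish (Fin.suc i))))
                                    (+-identityˡ _)

  module Characteristic (p : ℕ) (p-prime : Prime p) (char : fromℕ p ≈ 0#) where
    binomial-vanishes : ∀ k z → 0 < k → k < p → (p C k) × z ≈ 0#
    binomial-vanishes k z 0<k k<p with PrimeBinomial.prime∣binomial p-prime k 0<k k<p
    ... | divides q eq = begin
      (p C k) × z              ≈⟨ ×≈fromℕ* (p C k) z ⟩
      fromℕ (p C k) * z        ≈⟨ *-congʳ (trans (fromℕ-cong eq) (fromℕ-* q p)) ⟩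
      (fromℕ q * fromℕ p) * z  ≈⟨ *-congʳ (trans (*-congˡ char) (zeroʳ _)) ⟩
      0# * z                   ≈⟨ zeroˡ z ⟩
      0#                       ∎

    -- In the binomial expansion of (a + b)^p only the two outer terms survive.
    frobenius-+ : ∀ a b → (a + b) ^ p ≈ a ^ p + b ^ p
    frobenius-+ = expand p P.refl
      where
      expand : ∀ n → n ≡ p → ∀ a b → (a + b) ^ n ≈ a ^ n + b ^ n
      expand zero          P.refl = ⊥-elim (¬prime[0] p-prime)
      expand (suc zero)    P.refl = ⊥-elim (¬prime[1] p-prime)
      expand (suc (suc n)) P.refl a b = begin
        (a + b) ^ p                    ≈⟨ sym (^′≈^ _ p) ⟩
        (a + b) ^′ p                   ≈⟨ Binomial.theorem p a b ⟩
        sum t                          ≈⟨ +-congˡ (sum-last (suc n) (λ i → t (Fin.suc i)) middle-vanishes) ⟩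
        t Fin.zero + t (Fin.fromℕ p)   ≈⟨ +-cong first last ⟩
        b ^ p + a ^ p                  ≈⟨ +-comm _ _ ⟩
        a ^ p + b ^ p                  ∎
        where
        t = Binomial.binomialTerm a b p
        middle-vanishes : ∀ (i : Fin (suc n)) → t (Fin.suc (inject₁ i)) ≈ 0#
        middle-vanishes i = binomial-vanishes (suc (toℕ (inject₁ i))) _ (s≤s z≤n)
          (s≤s (P.subst (_< suc n) (P.sym (FinP.toℕ-inject₁ i)) (FinP.toℕ<n i)))
        first : t Fin.zero ≈ b ^ p
        first = trans (+-identityʳ _) (trans (*-identityˡ _) (^′≈^ b p))
        last : t (Fin.fromℕ p) ≈ a ^ p
        last = begin
          (p C toℕ (Fin.fromℕ p)) × ((a ^′ toℕ (Fin.fromℕ p)) * (b ^′ (p ∸ toℕ (Fin.fromℕ p))))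
            ≡⟨ P.cong (λ k → (p C k) × ((a ^′ k) * (b ^′ (p ∸ k)))) (FinP.toℕ-fromℕ p) ⟩
          (p C p) × ((a ^′ p) * (b ^′ (p ∸ p)))
            ≡⟨ P.cong₂ (λ u v → u × ((a ^′ p) * (b ^′ v))) (nCn≡1 p) (ℕP.n∸n≡0 p) ⟩
          1 × ((a ^′ p) * 1#)
            ≈⟨ trans (+-identityʳ _) (trans (*-identityʳ _) (^′≈^ a p)) ⟩
          a ^ p ∎

    frobenius-pow-+ : ∀ k a b → (a + b) ^ (p ℕ.^ k) ≈ a ^ (p ℕ.^ k) + b ^ (p ℕ.^ k)
    frobenius-pow-+ zero    a b = solve 2 (λ a b → (a :+ b) :* con (+ 1) := a :* con (+ 1) :+ b :* con (+ 1)) refl a b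
      where open Solver using (_:*_; con)
    frobenius-pow-+ (suc k) a b = begin
      (a + b) ^ (p ℕ.* p ℕ.^ k)                   ≈⟨ ^-* (a + b) p (p ℕ.^ k) ⟩
      ((a + b) ^ p) ^ (p ℕ.^ k)                   ≈⟨ ^-congˡ (p ℕ.^ k) (frobenius-+ a b) ⟩
      (a ^ p + b ^ p) ^ (p ℕ.^ k)                 ≈⟨ frobenius-pow-+ k (a ^ p) (b ^ p) ⟩
      (a ^ p) ^ (p ℕ.^ k) + (b ^ p) ^ (p ℕ.^ k)   ≈⟨ +-cong (sym (^-* a p (p ℕ.^ k))) (sym (^-* b p (p ℕ.^ k))) ⟩
      a ^ (p ℕ.* p ℕ.^ k) + b ^ (p ℕ.* p ℕ.^ k)   ∎

    frobenius-pow-- : ∀ k a b → (a - b) ^ (p ℕ.^ k) ≈ (a ^ (p ℕ.^ k)) - (b ^ (p ℕ.^ k))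
    frobenius-pow-- k a b = begin
      (a - b) ^ Q                        ≈⟨ solve 2 (λ u v → u := (u :+ v) :+ :- v) refl ((a - b) ^ Q) (b ^ Q) ⟩
      ((a - b) ^ Q + b ^ Q) - (b ^ Q)    ≈⟨ +-congʳ (sym (frobenius-pow-+ k (a - b) b)) ⟩
      (((a - b) + b) ^ Q) - (b ^ Q)      ≈⟨ +-congʳ (^-congˡ Q (solve 2 (λ x y → (x :+ :- y) :+ y := x) refl a b)) ⟩
      (a ^ Q) - (b ^ Q)                  ∎
      where Q = p ℕ.^ k


module PolynomialRing {c ℓ} (R : CommutativeRing c ℓ) where
  open import Data.Nat as ℕ using (ℕ; zero; suc)
  open import Data.List using (List; []; _∷_; map)
  open import Data.Product using (_,_)
  open import Relation.Binary.PropositionalEquality as P using (_≡_)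
  open RingFacts R
  open Poly rawRing
  open import Relation.Binary.Reasoning.Setoid setoid
  open Solver using (solve; _:=_; _:+_; _:*_)

  ≈P-refl : ∀ ps → ps ≈P ps
  ≈P-refl ps i = refl

  ≈P-sym : ∀ ps qs → ps ≈P qs → qs ≈P ps
  ≈P-sym ps qs e i = sym (e i)

  ≈P-trans : ∀ ps qs rs → ps ≈P qs → qs ≈P rs → ps ≈P rs
  ≈P-trans ps qs rs e f i = trans (e i) (f i)

  coeff-+ : ∀ ps qs i → coeff (addP ps qs) i ≈ coeff ps i + coeff qs i
  coeff-+ []       qs       i       = sym (+-identityˡ _)
  coeff-+ (p ∷ ps) []       i       = sym (+-identityʳ _)
  coeff-+ (p ∷ ps) (q ∷ qs) zero    = refl
  coeff-+ (p ∷ ps) (q ∷ qs) (suc i) = coeff-+ ps qs i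

  coeff-map : ∀ (f : Carrier → Carrier) → f 0# ≈ 0# → ∀ ps i → coeff (map f ps) i ≈ f (coeff ps i)
  coeff-map f f0≈0 []       i       = sym f0≈0
  coeff-map f f0≈0 (p ∷ ps) zero    = refl
  coeff-map f f0≈0 (p ∷ ps) (suc i) = coeff-map f f0≈0 ps i

  coeff-scale : ∀ a ps i → coeff (map (a *_) ps) i ≈ a * coeff ps i
  coeff-scale a = coeff-map (a *_) (zeroʳ a)

  coeff-neg : ∀ ps i → coeff (map -_ ps) i ≈ - coeff ps i
  coeff-neg = coeff-map -_ -0#≈0#

  -- the coefficient sequence of X·f
  shift : (ℕ → Carrier) → ℕ → Carrier
  shift f zero    = 0#
  shift f (suc i) = f i

  coeff-shift : ∀ ps i → coeff (0# ∷ ps) i ≡ shift (coeff ps) i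
  coeff-shift ps zero    = P.refl
  coeff-shift ps (suc i) = P.refl

  shift-cong : ∀ {f g} → (∀ i → f i ≈ g i) → ∀ i → shift f i ≈ shift g i
  shift-cong e zero    = refl
  shift-cong e (suc i) = e i

  shift-zero : ∀ i → shift (λ _ → 0#) i ≈ 0#
  shift-zero zero    = refl
  shift-zero (suc i) = refl

  shift-+ : ∀ f g i → shift (λ j → f j + g j) i ≈ shift f i + shift g i
  shift-+ f g zero    = sym (+-identityʳ 0#)
  shift-+ f g (suc i) = refl

  shift-scale : ∀ a f i → shift (λ j → a * f j) i ≈ a * shift f i
  shift-scale a f zero    = sym (zeroʳ a)
  shift-scale a f (suc i) = refl

  coeff-mul : ∀ a ps qs i → coeff (mulP (a ∷ ps) qs) i ≈ a * coeff qs i + shift (coeff (mulP ps qs)) i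
  coeff-mul a ps qs i = trans (coeff-+ (map (a *_) qs) (0# ∷ mulP ps qs) i)
    (+-cong (coeff-scale a qs i) (reflexive (coeff-shift (mulP ps qs) i)))

  ∷-cong : ∀ a b ps qs → a ≈ b → ps ≈P qs → (a ∷ ps) ≈P (b ∷ qs)
  ∷-cong a b ps qs a≈b ps≈qs zero    = a≈b
  ∷-cong a b ps qs a≈b ps≈qs (suc i) = ps≈qs i

  addP-cong : ∀ ps ps' qs qs' → ps ≈P ps' → qs ≈P qs' → addP ps qs ≈P addP ps' qs'
  addP-cong ps ps' qs qs' e f i = trans (coeff-+ ps qs i) (trans (+-cong (e i) (f i)) (sym (coeff-+ ps' qs' i)))

  neg-cong : ∀ ps qs → ps ≈P qs → map -_ ps ≈P map -_ qs
  neg-cong ps qs e i = trans (coeff-neg ps i) (trans (-‿cong (e i)) (sym (coeff-neg qs i)))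

  scale-cong : ∀ a b ps qs → a ≈ b → ps ≈P qs → map (a *_) ps ≈P map (b *_) qs
  scale-cong a b ps qs e f i = trans (coeff-scale a ps i) (trans (*-cong e (f i)) (sym (coeff-scale b qs i)))

  mulP-zeroˡ : ∀ ps qs → ps ≈P [] → mulP ps qs ≈P []
  mulP-zeroˡ []       qs e = ≈P-refl []
  mulP-zeroˡ (p ∷ ps) qs e i = begin
    coeff (mulP (p ∷ ps) qs) i                    ≈⟨ coeff-mul p ps qs i ⟩
    p * coeff qs i + shift (coeff (mulP ps qs)) i ≈⟨ +-cong (trans (*-congʳ (e 0)) (zeroˡ _))
                                                             (shift-cong (mulP-zeroˡ ps qs (λ j → e (suc j))) i) ⟩
    0# + shift (λ _ → 0#) i                       ≈⟨ trans (+-identityˡ _) (shift-zero i) ⟩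
    0#                                            ∎

  mulP-congˡ : ∀ ps ps' qs → ps ≈P ps' → mulP ps qs ≈P mulP ps' qs
  mulP-congˡ []       []         qs e = ≈P-refl []
  mulP-congˡ []       (p' ∷ ps') qs e =
    ≈P-sym (mulP (p' ∷ ps') qs) [] (mulP-zeroˡ (p' ∷ ps') qs (≈P-sym [] (p' ∷ ps') e))
  mulP-congˡ (p ∷ ps) []         qs e = mulP-zeroˡ (p ∷ ps) qs e
  mulP-congˡ (p ∷ ps) (p' ∷ ps') qs e =
    addP-cong (map (p *_) qs) (map (p' *_) qs) (0# ∷ mulP ps qs) (0# ∷ mulP ps' qs)
      (scale-cong p p' qs qs (e 0) (≈P-refl qs))
      (∷-cong 0# 0# (mulP ps qs) (mulP ps' qs) refl (mulP-congˡ ps ps' qs (λ j → e (suc j))))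

  mulP-congʳ : ∀ ps qs qs' → qs ≈P qs' → mulP ps qs ≈P mulP ps qs'
  mulP-congʳ []       qs qs' e = ≈P-refl []
  mulP-congʳ (p ∷ ps) qs qs' e =
    addP-cong (map (p *_) qs) (map (p *_) qs') (0# ∷ mulP ps qs) (0# ∷ mulP ps qs')
      (scale-cong p p qs qs' refl e)
      (∷-cong 0# 0# (mulP ps qs) (mulP ps qs') refl (mulP-congʳ ps qs qs' e))

  mulP-cong : ∀ ps ps' qs qs' → ps ≈P ps' → qs ≈P qs' → mulP ps qs ≈P mulP ps' qs'
  mulP-cong ps ps' qs qs' e f =
    ≈P-trans (mulP ps qs) (mulP ps' qs) (mulP ps' qs') (mulP-congˡ ps ps' qs e) (mulP-congʳ ps' qs qs' f)

  addP-assoc : ∀ ps qs rs → addP (addP ps qs) rs ≈P addP ps (addP qs rs)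
  addP-assoc ps qs rs i = begin
    coeff (addP (addP ps qs) rs) i            ≈⟨ trans (coeff-+ (addP ps qs) rs i) (+-congʳ (coeff-+ ps qs i)) ⟩
    (coeff ps i + coeff qs i) + coeff rs i    ≈⟨ +-assoc _ _ _ ⟩
    coeff ps i + (coeff qs i + coeff rs i)    ≈⟨ sym (trans (coeff-+ ps (addP qs rs) i) (+-congˡ (coeff-+ qs rs i))) ⟩
    coeff (addP ps (addP qs rs)) i            ∎

  addP-comm : ∀ ps qs → addP ps qs ≈P addP qs ps
  addP-comm ps qs i = trans (coeff-+ ps qs i) (trans (+-comm _ _) (sym (coeff-+ qs ps i)))

  addP-identityʳ : ∀ ps → addP ps [] ≈P ps
  addP-identityʳ ps i = trans (coeff-+ ps [] i) (+-identityʳ _)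

  addP-inverseˡ : ∀ ps → addP (map -_ ps) ps ≈P []
  addP-inverseˡ ps i = trans (coeff-+ (map -_ ps) ps i) (trans (+-congʳ (coeff-neg ps i)) (-‿inverseˡ _))

  addP-inverseʳ : ∀ ps → addP ps (map -_ ps) ≈P []
  addP-inverseʳ ps i = trans (addP-comm ps (map -_ ps) i) (addP-inverseˡ ps i)

  mulP-distribʳ : ∀ ps qs rs → mulP (addP ps qs) rs ≈P addP (mulP ps rs) (mulP qs rs)
  mulP-distribʳ []       qs       rs i = refl
  mulP-distribʳ (p ∷ ps) []       rs i = sym (trans (coeff-+ (mulP (p ∷ ps) rs) [] i) (+-identityʳ _))
  mulP-distribʳ (p ∷ ps) (q ∷ qs) rs i = begin
    coeff (mulP ((p + q) ∷ addP ps qs) rs) i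
      ≈⟨ coeff-mul (p + q) (addP ps qs) rs i ⟩
    (p + q) * r + shift (coeff (mulP (addP ps qs) rs)) i
      ≈⟨ +-congˡ (shift-cong (λ j → trans (mulP-distribʳ ps qs rs j) (coeff-+ (mulP ps rs) (mulP qs rs) j)) i) ⟩
    (p + q) * r + shift (λ j → coeff (mulP ps rs) j + coeff (mulP qs rs) j) i
      ≈⟨ +-congˡ (shift-+ (coeff (mulP ps rs)) (coeff (mulP qs rs)) i) ⟩
    (p + q) * r + (shift (coeff (mulP ps rs)) i + shift (coeff (mulP qs rs)) i)
      ≈⟨ solve 5 (λ P Q Rr A B → (P :+ Q) :* Rr :+ (A :+ B) := (P :* Rr :+ A) :+ (Q :* Rr :+ B)) refl p q r _ _ ⟩
    (p * r + shift (coeff (mulP ps rs)) i) + (q * r + shift (coeff (mulP qs rs)) i)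
      ≈⟨ sym (+-cong (coeff-mul p ps rs i) (coeff-mul q qs rs i)) ⟩
    coeff (mulP (p ∷ ps) rs) i + coeff (mulP (q ∷ qs) rs) i
      ≈⟨ sym (coeff-+ (mulP (p ∷ ps) rs) (mulP (q ∷ qs) rs) i) ⟩
    coeff (addP (mulP (p ∷ ps) rs) (mulP (q ∷ qs) rs)) i ∎
    where r = coeff rs i

  mulP-scale : ∀ a qs rs → mulP (map (a *_) qs) rs ≈P map (a *_) (mulP qs rs)
  mulP-scale a []       rs i = refl
  mulP-scale a (q ∷ qs) rs i = begin
    coeff (mulP ((a * q) ∷ map (a *_) qs) rs) i
      ≈⟨ coeff-mul (a * q) (map (a *_) qs) rs i ⟩
    (a * q) * coeff rs i + shift (coeff (mulP (map (a *_) qs) rs)) i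
      ≈⟨ +-congˡ (trans (shift-cong (λ j → trans (mulP-scale a qs rs j) (coeff-scale a (mulP qs rs) j)) i)
                        (shift-scale a _ i)) ⟩
    (a * q) * coeff rs i + a * shift (coeff (mulP qs rs)) i
      ≈⟨ solve 4 (λ A Q Rr S → (A :* Q) :* Rr :+ A :* S := A :* (Q :* Rr :+ S)) refl a q (coeff rs i) _ ⟩
    a * (q * coeff rs i + shift (coeff (mulP qs rs)) i)
      ≈⟨ *-congˡ (sym (coeff-mul q qs rs i)) ⟩
    a * coeff (mulP (q ∷ qs) rs) i
      ≈⟨ sym (coeff-scale a (mulP (q ∷ qs) rs) i) ⟩
    coeff (map (a *_) (mulP (q ∷ qs) rs)) i ∎

  mulP-shift : ∀ ps rs → mulP (0# ∷ ps) rs ≈P (0# ∷ mulP ps rs)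
  mulP-shift ps rs i = trans (coeff-mul 0# ps rs i)
    (trans (+-congʳ (zeroˡ _)) (trans (+-identityˡ _) (reflexive (P.sym (coeff-shift (mulP ps rs) i)))))

  mulP-assoc : ∀ ps qs rs → mulP (mulP ps qs) rs ≈P mulP ps (mulP qs rs)
  mulP-assoc []       qs rs i = refl
  mulP-assoc (p ∷ ps) qs rs =
    ≈P-trans (mulP (mulP (p ∷ ps) qs) rs) (addP (mulP (map (p *_) qs) rs) (mulP (0# ∷ mulP ps qs) rs))
             (mulP (p ∷ ps) (mulP qs rs))
      (mulP-distribʳ (map (p *_) qs) (0# ∷ mulP ps qs) rs)
      (addP-cong (mulP (map (p *_) qs) rs) (map (p *_) (mulP qs rs))
                 (mulP (0# ∷ mulP ps qs) rs) (0# ∷ mulP ps (mulP qs rs))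
        (mulP-scale p qs rs)
        (≈P-trans (mulP (0# ∷ mulP ps qs) rs) (0# ∷ mulP (mulP ps qs) rs) (0# ∷ mulP ps (mulP qs rs))
          (mulP-shift (mulP ps qs) rs)
          (∷-cong 0# 0# (mulP (mulP ps qs) rs) (mulP ps (mulP qs rs)) refl (mulP-assoc ps qs rs))))

  mulP-zeroʳ : ∀ ps → mulP ps [] ≈P []
  mulP-zeroʳ []       i       = refl
  mulP-zeroʳ (p ∷ ps) zero    = refl
  mulP-zeroʳ (p ∷ ps) (suc i) = mulP-zeroʳ ps i

  mulP-consʳ : ∀ ps q qs → mulP ps (q ∷ qs) ≈P addP (map (_* q) ps) (0# ∷ mulP ps qs)
  mulP-consʳ []       q qs zero    = refl
  mulP-consʳ []       q qs (suc i) = refl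
  mulP-consʳ (p ∷ ps) q qs zero    = refl
  mulP-consʳ (p ∷ ps) q qs (suc j) = begin
    coeff (addP (map (p *_) qs) (mulP ps (q ∷ qs))) j
      ≈⟨ coeff-+ (map (p *_) qs) (mulP ps (q ∷ qs)) j ⟩
    coeff (map (p *_) qs) j + coeff (mulP ps (q ∷ qs)) j
      ≈⟨ +-cong (coeff-scale p qs j) (trans (mulP-consʳ ps q qs j) (coeff-+ (map (_* q) ps) (0# ∷ mulP ps qs) j)) ⟩
    p * coeff qs j + (coeff (map (_* q) ps) j + coeff (0# ∷ mulP ps qs) j)
      ≈⟨ solve 3 (λ A B C → A :+ (B :+ C) := B :+ (A :+ C)) refl _ _ _ ⟩
    coeff (map (_* q) ps) j + (p * coeff qs j + coeff (0# ∷ mulP ps qs) j)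
      ≈⟨ +-congˡ (trans (+-congˡ (reflexive (coeff-shift (mulP ps qs) j))) (sym (coeff-mul p ps qs j))) ⟩
    coeff (map (_* q) ps) j + coeff (mulP (p ∷ ps) qs) j
      ≈⟨ sym (coeff-+ (map (_* q) ps) (mulP (p ∷ ps) qs) j) ⟩
    coeff (addP (map (_* q) ps) (mulP (p ∷ ps) qs)) j ∎

  mulP-comm : ∀ ps qs → mulP ps qs ≈P mulP qs ps
  mulP-comm []       qs   = ≈P-sym (mulP qs []) [] (mulP-zeroʳ qs)
  mulP-comm (p ∷ ps) qs i = begin
    coeff (mulP (p ∷ ps) qs) i                      ≈⟨ coeff-mul p ps qs i ⟩
    p * coeff qs i + shift (coeff (mulP ps qs)) i   ≈⟨ +-cong (*-comm _ _) (shift-cong (mulP-comm ps qs) i) ⟩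
    coeff qs i * p + shift (coeff (mulP qs ps)) i   ≈⟨ +-cong (sym (coeff-map (_* p) (zeroˡ p) qs i))
                                                               (reflexive (P.sym (coeff-shift (mulP qs ps) i))) ⟩
    coeff (map (_* p) qs) i + coeff (0# ∷ mulP qs ps) i ≈⟨ sym (coeff-+ (map (_* p) qs) (0# ∷ mulP qs ps) i) ⟩
    coeff (addP (map (_* p) qs) (0# ∷ mulP qs ps)) i   ≈⟨ sym (mulP-consʳ qs p ps i) ⟩
    coeff (mulP qs (p ∷ ps)) i                      ∎

  mulP-identityˡ : ∀ qs → mulP (1# ∷ []) qs ≈P qs
  mulP-identityˡ qs i = trans (coeff-mul 1# [] qs i) (trans (+-cong (*-identityˡ _) (shift-zero i)) (+-identityʳ _))

  mulP-distribˡ : ∀ ps qs rs → mulP ps (addP qs rs) ≈P addP (mulP ps qs) (mulP ps rs)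
  mulP-distribˡ ps qs rs i = begin
    coeff (mulP ps (addP qs rs)) i                ≈⟨ mulP-comm ps (addP qs rs) i ⟩
    coeff (mulP (addP qs rs) ps) i                ≈⟨ mulP-distribʳ qs rs ps i ⟩
    coeff (addP (mulP qs ps) (mulP rs ps)) i      ≈⟨ addP-cong (mulP qs ps) (mulP ps qs) (mulP rs ps) (mulP ps rs)
                                                                (mulP-comm qs ps) (mulP-comm rs ps) i ⟩
    coeff (addP (mulP ps qs) (mulP ps rs)) i      ∎

  polynomialRing : CommutativeRing c ℓ
  polynomialRing = record
    { Carrier = List Carrier
    ; _≈_ = _≈P_
    ; _+_ = addP
    ; _*_ = mulP
    ; -_  = map (-_)
    ; 0#  = []
    ; 1#  = 1# ∷ []
    ; isCommutativeRing = record
      { isRing = record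
        { +-isAbelianGroup = record
          { isGroup = record
            { isMonoid = record
              { isSemigroup = record
                { isMagma = record
                  { isEquivalence = record
                    { refl  = λ {ps} → ≈P-refl ps
                    ; sym   = λ {ps} {qs} → ≈P-sym ps qs
                    ; trans = λ {ps} {qs} {rs} → ≈P-trans ps qs rs }
                  ; ∙-cong = λ {ps} {ps'} {qs} {qs'} → addP-cong ps ps' qs qs' }
                ; assoc = addP-assoc }
              ; identity = ≈P-refl , addP-identityʳ }
            ; inverse = addP-inverseˡ , addP-inverseʳ
            ; ⁻¹-cong = λ {ps} {qs} → neg-cong ps qs }
          ; comm = addP-comm }
        ; *-cong = λ {ps} {ps'} {qs} {qs'} → mulP-cong ps ps' qs qs'
        ; *-assoc = mulP-assoc
        ; *-identity = mulP-identityˡ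
                     , (λ ps → ≈P-trans (mulP ps (1# ∷ [])) (mulP (1# ∷ []) ps) ps
                                 (mulP-comm ps (1# ∷ [])) (mulP-identityˡ ps))
        ; distrib = mulP-distribˡ , (λ ps qs rs → mulP-distribʳ qs rs ps) }
      ; *-comm = mulP-comm } }

  fromℕ-const : ∀ n → RawOps.fromℕ polyRawRing n ≈P const (fromℕ n)
  fromℕ-const zero    zero    = refl
  fromℕ-const zero    (suc i) = refl
  fromℕ-const (suc n) i = trans (coeff-+ (1# ∷ []) (RawOps.fromℕ polyRawRing n) i)
    (trans (+-congˡ (fromℕ-const n i)) (sym (coeff-+ (1# ∷ []) (const (fromℕ n)) i)))


-- Its elements t and 1 - t are the two roots of T² - T + x, so the
-- Lucas identity turns U_n(x) into the difference t^n - (1-t)^n of root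
-- powers, which is how parts (2) and (3) are proved.
module QuadraticAlgebra {c ℓ} (S : CommutativeRing c ℓ) (x : CommutativeRing.Carrier S) where
  open import Data.Nat as ℕ using (ℕ; zero; suc)
  open import Data.Integer using (+_)
  import Data.Nat.Properties as ℕP
  open import Data.Product using (_,_)
  open import Relation.Binary.PropositionalEquality as P using (_≡_)
  open RingFacts S
  open Lucas S using (U)
  open Solver using (solve; _:=_; _:+_; _:*_; :-_; con)

  -- ⟨ a , b ⟩ stands for a + b·t
  record Q : Set c where
    constructor ⟨_,_⟩
    field
      re im : Carrier
  open Q public

  infix 4 _≈Q_
  record _≈Q_ (u v : Q) : Set ℓ where
    constructor ⟨_,_⟩
    field
      re≈ : re u ≈ re v
      im≈ : im u ≈ im v
  open _≈Q_ public

  infixl 6 _+Q_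
  infixl 7 _*Q_
  _+Q_ : Q → Q → Q
  u +Q v = ⟨ re u + re v , im u + im v ⟩

  -- (a + bt)(c + dt) = ac + (ad + bc)t + bd·t²  with  t² = t - x
  _*Q_ : Q → Q → Q
  u *Q v = ⟨ re u * re v + - (x * (im u * im v)) , (re u * im v + im u * re v) + im u * im v ⟩

  -Q_ : Q → Q
  -Q u = ⟨ - re u , - im u ⟩

  quadraticRing : CommutativeRing c ℓ
  quadraticRing = record
    { Carrier = Q ; _≈_ = _≈Q_ ; _+_ = _+Q_ ; _*_ = _*Q_ ; -_ = -Q_ ; 0# = ⟨ 0# , 0# ⟩ ; 1# = ⟨ 1# , 0# ⟩
    ; isCommutativeRing = record
      { isRing = record
        { +-isAbelianGroup = record
          { isGroup = record
            { isMonoid = record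
              { isSemigroup = record
                { isMagma = record
                  { isEquivalence = record
                    { refl  = ⟨ refl , refl ⟩
                    ; sym   = λ e → ⟨ sym (re≈ e) , sym (im≈ e) ⟩
                    ; trans = λ e f → ⟨ trans (re≈ e) (re≈ f) , trans (im≈ e) (im≈ f) ⟩ }
                  ; ∙-cong = λ e f → ⟨ +-cong (re≈ e) (re≈ f) , +-cong (im≈ e) (im≈ f) ⟩ }
                ; assoc = λ u v w → ⟨ +-assoc _ _ _ , +-assoc _ _ _ ⟩ }
              ; identity = (λ u → ⟨ +-identityˡ _ , +-identityˡ _ ⟩) , (λ u → ⟨ +-identityʳ _ , +-identityʳ _ ⟩) }
            ; inverse = (λ u → ⟨ -‿inverseˡ _ , -‿inverseˡ _ ⟩) , (λ u → ⟨ -‿inverseʳ _ , -‿inverseʳ _ ⟩)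
            ; ⁻¹-cong = λ e → ⟨ -‿cong (re≈ e) , -‿cong (im≈ e) ⟩ }
          ; comm = λ u v → ⟨ +-comm _ _ , +-comm _ _ ⟩ }
        ; *-cong = λ e f →
            ⟨ +-cong (*-cong (re≈ e) (re≈ f)) (-‿cong (*-congˡ (*-cong (im≈ e) (im≈ f))))
            , +-cong (+-cong (*-cong (re≈ e) (im≈ f)) (*-cong (im≈ e) (re≈ f))) (*-cong (im≈ e) (im≈ f)) ⟩
        ; *-assoc = λ u v w →
            ⟨ solve 7 (λ X a b c d e f →
                (((a :* c) :+ :- (X :* (b :* d))) :* e) :+ :- (X :* ((((a :* d) :+ (b :* c)) :+ (b :* d)) :* f))
                := (a :* ((c :* e) :+ :- (X :* (d :* f)))) :+ :- (X :* (b :* (((c :* f) :+ (d :* e)) :+ (d :* f)))))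
                refl x (re u) (im u) (re v) (im v) (re w) (im w)
            , solve 7 (λ X a b c d e f →
                ((((a :* c) :+ :- (X :* (b :* d))) :* f) :+ ((((a :* d) :+ (b :* c)) :+ (b :* d)) :* e))
                  :+ ((((a :* d) :+ (b :* c)) :+ (b :* d)) :* f)
                := ((a :* (((c :* f) :+ (d :* e)) :+ (d :* f))) :+ (b :* ((c :* e) :+ :- (X :* (d :* f)))))
                  :+ (b :* (((c :* f) :+ (d :* e)) :+ (d :* f))))
                refl x (re u) (im u) (re v) (im v) (re w) (im w) ⟩
        ; *-identity =
            (λ u → ⟨ solve 3 (λ X a b → con (+ 1) :* a :+ :- (X :* (con (+ 0) :* b)) := a) refl x (re u) (im u)
                   , solve 3 (λ X a b → (con (+ 1) :* b :+ con (+ 0) :* a) :+ con (+ 0) :* b := b) refl x (re u) (im u) ⟩) ,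
            (λ u → ⟨ solve 3 (λ X a b → a :* con (+ 1) :+ :- (X :* (b :* con (+ 0))) := a) refl x (re u) (im u)
                   , solve 3 (λ X a b → (a :* con (+ 0) :+ b :* con (+ 1)) :+ b :* con (+ 0) := b) refl x (re u) (im u) ⟩)
        ; distrib =
            (λ u v w →
              ⟨ solve 7 (λ X a b c d e f → a :* (c :+ e) :+ :- (X :* (b :* (d :+ f)))
                          := (a :* c :+ :- (X :* (b :* d))) :+ (a :* e :+ :- (X :* (b :* f))))
                        refl x (re u) (im u) (re v) (im v) (re w) (im w)
              , solve 7 (λ X a b c d e f → (a :* (d :+ f) :+ b :* (c :+ e)) :+ b :* (d :+ f)
                          := ((a :* d :+ b :* c) :+ b :* d) :+ ((a :* f :+ b :* e) :+ b :* f))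
                        refl x (re u) (im u) (re v) (im v) (re w) (im w) ⟩) ,
            (λ u v w →
              ⟨ solve 7 (λ X a b c d e f → (c :+ e) :* a :+ :- (X :* ((d :+ f) :* b))
                          := (c :* a :+ :- (X :* (d :* b))) :+ (e :* a :+ :- (X :* (f :* b))))
                        refl x (re u) (im u) (re v) (im v) (re w) (im w)
              , solve 7 (λ X a b c d e f → ((c :+ e) :* b :+ (d :+ f) :* a) :+ (d :+ f) :* b
                          := ((c :* b :+ d :* a) :+ d :* b) :+ ((e :* b :+ f :* a) :+ f :* b))
                        refl x (re u) (im u) (re v) (im v) (re w) (im w) ⟩) }
      ; *-comm = λ u v →
          ⟨ solve 5 (λ X a b c d → a :* c :+ :- (X :* (b :* d)) := c :* a :+ :- (X :* (d :* b)))
                    refl x (re u) (im u) (re v) (im v)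
          , solve 5 (λ X a b c d → (a :* d :+ b :* c) :+ b :* d := (c :* b :+ d :* a) :+ d :* b)
                    refl x (re u) (im u) (re v) (im v) ⟩ } }

  module A = RingFacts quadraticRing
  open A public using () renaming (_^_ to _^Q_; _-_ to _-Q_; 1# to 1Q; 0# to 0Q)

  ι : Carrier → Q
  ι a = ⟨ a , 0# ⟩

  ι-* : ∀ a b → ι a *Q ι b ≈Q ι (a * b)
  ι-* a b = ⟨ solve 3 (λ X a b → a :* b :+ :- (X :* (con (+ 0) :* con (+ 0))) := a :* b) refl x a b
            , solve 3 (λ X a b → (a :* con (+ 0) :+ con (+ 0) :* b) :+ con (+ 0) :* con (+ 0) := con (+ 0)) refl x a b ⟩

  ι-- : ∀ a b → ι a -Q ι b ≈Q ι (a - b)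
  ι-- a b = ⟨ refl , trans (+-congˡ -0#≈0#) (+-identityʳ 0#) ⟩

  ι-^ : ∀ a n → ι a ^Q n ≈Q ι (a ^ n)
  ι-^ a zero    = A.refl
  ι-^ a (suc n) = A.trans (A.*-congˡ (ι-^ a n)) (ι-* a (a ^ n))

  ι-fromℕ : ∀ n → A.fromℕ n ≈Q ι (fromℕ n)
  ι-fromℕ zero    = A.refl
  ι-fromℕ (suc n) = ⟨ +-congˡ (re≈ (ι-fromℕ n)) , trans (+-congˡ (im≈ (ι-fromℕ n))) (+-identityʳ 0#) ⟩

  U-ι : ∀ y n → Lucas.U quadraticRing (ι y) n ≈Q ι (U y n)
  U-ι y zero          = A.refl
  U-ι y (suc zero)    = A.refl
  U-ι y (suc (suc n)) =
    A.trans (A.+-cong (U-ι y (suc n)) (A.-‿cong (A.trans (A.*-congˡ (U-ι y n)) (ι-* y (U y n)))))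
            (ι-- (U y (suc n)) (y * U y n))

  -- The root t and the coefficient δ = 2t - 1 of the Lucas identity.
  t δ : Q
  t = ⟨ 0# , 1# ⟩
  δ = ⟨ - 1# , fromℕ 2 ⟩

  t-roots : t *Q (1Q -Q t) ≈Q ι x
  t-roots = ⟨ solve 1 (λ X → con (+ 0) :* (con (+ 1) :+ :- con (+ 0)) :+ :- (X :* (con (+ 1) :* (con (+ 0) :+ :- con (+ 1))))
                          := X) refl x
            , solve 0 ((con (+ 0) :* (con (+ 0) :+ :- con (+ 1)) :+ con (+ 1) :* (con (+ 1) :+ :- con (+ 0)))
                         :+ con (+ 1) :* (con (+ 0) :+ :- con (+ 1)) := con (+ 0)) refl ⟩

  δ-form : (A.fromℕ 2 *Q t) -Q 1Q ≈Q δ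
  δ-form = ⟨ solve 1 (λ X → (con (+ 1) :+ (con (+ 1) :+ con (+ 0))) :* con (+ 0)
                             :+ :- (X :* ((con (+ 0) :+ (con (+ 0) :+ con (+ 0))) :* con (+ 1))) :+ :- con (+ 1)
                          := :- con (+ 1)) refl x
           , solve 0 (((con (+ 1) :+ (con (+ 1) :+ con (+ 0))) :* con (+ 1) :+ (con (+ 0) :+ (con (+ 0) :+ con (+ 0))) :* con (+ 0))
                        :+ (con (+ 0) :+ (con (+ 0) :+ con (+ 0))) :* con (+ 1) :+ :- con (+ 0)
                      := con (+ 2)) refl ⟩

  -- δ·ι(a) = ⟨ -a , 2a ⟩, so δ can be cancelled against embedded elements
  δ-cancel : ∀ {a b} → δ *Q ι a ≈Q δ *Q ι b → a ≈ b
  δ-cancel {a} {b} e = begin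
    a                                               ≈⟨ solve 2 (λ X a → a := :- (:- con (+ 1) :* a :+ :- (X :* (con (+ 2) :* con (+ 0))))) refl x a ⟩
    - (- 1# * a + - (x * (fromℕ 2 * 0#)))          ≈⟨ -‿cong (re≈ e) ⟩
    - (- 1# * b + - (x * (fromℕ 2 * 0#)))          ≈⟨ solve 2 (λ X b → :- (:- con (+ 1) :* b :+ :- (X :* (con (+ 2) :* con (+ 0)))) := b) refl x b ⟩
    b                                               ∎
    where open import Relation.Binary.Reasoning.Setoid setoid

  δ² : δ *Q δ ≈Q ι (1# - (fromℕ 4 * x))
  δ² = ⟨ solve 1 (λ X → (:- con (+ 1)) :* (:- con (+ 1)) :+ :- (X :* (con (+ 2) :* con (+ 2)))
                      := con (+ 1) :+ :- (con (+ 4) :* X)) refl x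
       , solve 0 (((:- con (+ 1)) :* con (+ 2) :+ con (+ 2) :* (:- con (+ 1))) :+ con (+ 2) :* con (+ 2)
                    := con (+ 0)) refl ⟩

  -- The Lucas identity in Q at y = t, where y(1 - y) = x.
  root-difference : ∀ n → (t ^Q n) -Q ((1Q -Q t) ^Q n) ≈Q δ *Q ι (U x n)
  root-difference n = begin
    (t ^Q n) -Q ((1Q -Q t) ^Q n)                               ≈⟨ A.sym (Lucas.lucas-identity quadraticRing t n) ⟩
    ((A.fromℕ 2 *Q t) -Q 1Q) *Q Lucas.U quadraticRing (t *Q (1Q -Q t)) n
      ≈⟨ A.*-cong δ-form (A.trans (Lucas.U-cong quadraticRing t-roots n) (U-ι x n)) ⟩
    δ *Q ι (U x n)                                             ∎
    where open import Relation.Binary.Reasoning.Setoid A.setoid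

  δ-odd-power : ∀ h → δ ^Q suc (h ℕ.* 2) ≈Q δ *Q ι ((1# - (fromℕ 4 * x)) ^ h)
  δ-odd-power h = begin
    δ *Q (δ ^Q (h ℕ.* 2))           ≡⟨ P.cong (λ e → δ *Q (δ ^Q e)) (ℕP.*-comm h 2) ⟩
    δ *Q (δ ^Q (2 ℕ.* h))           ≈⟨ A.*-congˡ (A.^-* δ 2 h) ⟩
    δ *Q ((δ ^Q 2) ^Q h)            ≈⟨ A.*-congˡ (A.^-congˡ h (A.trans (A.*-congˡ (A.*-identityʳ δ)) δ²)) ⟩
    δ *Q (ι (1# - (fromℕ 4 * x)) ^Q h) ≈⟨ A.*-congˡ (ι-^ _ h) ⟩
    δ *Q ι ((1# - (fromℕ 4 * x)) ^ h) ∎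
    where open import Relation.Binary.Reasoning.Setoid A.setoid


-- Proof: in S[t]/(t² - t + x) the Frobenius power u ↦ u^{p^k} is additive,
-- so δ·U_{np^k} = t^{np^k} - (1-t)^{np^k} = (t^n - (1-t)^n)^{p^k} = (δ·U_n)^{p^k},
-- and δ^{p^k} = δ·(1 - 4x)^h; finally δ cancels.
module LucasFrobenius {c ℓ} (S : CommutativeRing c ℓ) where
  open import Data.Nat as ℕ using (ℕ; suc)
  open import Data.Nat.Primality using (Prime)
  open import Relation.Binary.PropositionalEquality as P using (_≡_)
  open RingFacts S
  open Lucas S using (U)

  U-frobenius : ∀ p → Prime p → fromℕ p ≈ 0# → ∀ x n k h → p ℕ.^ k ≡ suc (h ℕ.* 2) →
                U x (n ℕ.* p ℕ.^ k) ≈ (1# - (fromℕ 4 * x)) ^ h * U x n ^ (p ℕ.^ k)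
  U-frobenius p p-prime char x n k h p^k-odd = δ-cancel (begin
    δ *Q ι (U x (n ℕ.* Qk))                          ≈⟨ A.sym (root-difference (n ℕ.* Qk)) ⟩
    (t ^Q (n ℕ.* Qk)) -Q ((1Q -Q t) ^Q (n ℕ.* Qk))   ≈⟨ A.+-cong (A.^-* t n Qk) (A.-‿cong (A.^-* (1Q -Q t) n Qk)) ⟩
    ((t ^Q n) ^Q Qk) -Q (((1Q -Q t) ^Q n) ^Q Qk)     ≈⟨ A.sym (frobenius-pow-- k (t ^Q n) ((1Q -Q t) ^Q n)) ⟩
    ((t ^Q n) -Q ((1Q -Q t) ^Q n)) ^Q Qk             ≈⟨ A.^-congˡ Qk (root-difference n) ⟩
    (δ *Q ι (U x n)) ^Q Qk                           ≈⟨ A.^-distrib-* δ (ι (U x n)) Qk ⟩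
    (δ ^Q Qk) *Q (ι (U x n) ^Q Qk)                   ≡⟨ P.cong (λ e → (δ ^Q e) *Q (ι (U x n) ^Q Qk)) p^k-odd ⟩
    (δ ^Q suc (h ℕ.* 2)) *Q (ι (U x n) ^Q Qk)        ≈⟨ A.*-cong (δ-odd-power h) (ι-^ (U x n) Qk) ⟩
    (δ *Q ι (E ^ h)) *Q ι (U x n ^ Qk)               ≈⟨ A.*-assoc _ _ _ ⟩
    δ *Q (ι (E ^ h) *Q ι (U x n ^ Qk))               ≈⟨ A.*-congˡ (ι-* _ _) ⟩
    δ *Q ι (E ^ h * U x n ^ Qk)                      ∎)
    where
    open QuadraticAlgebra S x
    open import Relation.Binary.Reasoning.Setoid A.setoid
    open Frobenius.Characteristic quadraticRing p p-prime (A.trans (ι-fromℕ p) ⟨ char , refl ⟩)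
    Qk = p ℕ.^ k
    E = 1# - (fromℕ 4 * x)


module Part2 where
  open import Level using (0ℓ)
  open import Data.Nat as ℕ using (ℕ; suc; _∸_; _/_; _%_; _≤_)
  open import Data.Nat.DivMod using (m*n/n≡m)
  open import Data.Nat.Primality using (Prime)
  open import Relation.Binary.PropositionalEquality as P using (_≡_)

  part2 : ∀ (K : Field 0ℓ 0ℓ) p → Prime p → p % 2 ≡ 1 → HasCharacteristic K p →
          ∀ n k → 1 ≤ n → Claim2 p n k K
  part2 K p p-prime p-odd char (suc n) k _ = begin
    F (suc n ℕ.* Qk) 1# X                ≡⟨ P.cong (λ e → F (suc n ℕ.* e) 1# X) Qk-odd ⟩
    F (suc n ℕ.* suc (h ℕ.* 2)) 1# X     ≈⟨ Expansion.F≈U X (h ℕ.* 2 ℕ.+ n ℕ.* suc (h ℕ.* 2)) ⟩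
    U X (suc n ℕ.* suc (h ℕ.* 2))        ≡⟨ P.cong (λ e → U X (suc n ℕ.* e)) (P.sym Qk-odd) ⟩
    U X (suc n ℕ.* Qk)                   ≈⟨ U-frobenius p p-prime char-X X (suc n) k h Qk-odd ⟩
    (E ^ h) * (U X (suc n) ^ Qk)         ≈⟨ *-comm (E ^ h) (U X (suc n) ^ Qk) ⟩
    (U X (suc n) ^ Qk) * (E ^ h)         ≈⟨ *-cong {U X (suc n) ^ Qk} {F (suc n) 1# X ^ Qk} {E ^ h} {E′ ^ h}
                                              (^-congˡ Qk {U X (suc n)} {F (suc n) 1# X} (sym {F (suc n) 1# X} {U X (suc n)} (Expansion.F≈U X n)))
                                              (^-congˡ h {E} {E′} E≈E′) ⟩
    (F (suc n) 1# X ^ Qk) * (E′ ^ h)     ≡⟨ P.cong (λ e → (F (suc n) 1# X ^ Qk) * (E′ ^ e)) (P.sym half-Qk) ⟩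
    (F (suc n) 1# X ^ Qk) * (E′ ^ ((Qk ∸ 1) / 2)) ∎
    where
    open Field K using (commutativeRing)
    module K = RingFacts commutativeRing
    open PolynomialRing commutativeRing
    open Poly K.rawRing using (X; const)
    open RingFacts polynomialRing
    open Lucas polynomialRing
    open LucasFrobenius polynomialRing
    open import Relation.Binary.Reasoning.Setoid setoid
    Qk = p ℕ.^ k
    h = Qk / 2
    Qk-odd : Qk ≡ suc (h ℕ.* 2)
    Qk-odd = NatFacts.odd-form Qk (NatFacts.odd-pow p p-odd k)
    half-Qk : (Qk ∸ 1) / 2 ≡ h
    half-Qk = P.trans (P.cong (λ e → (e ∸ 1) / 2) Qk-odd) (m*n/n≡m h 2)
    char-X : fromℕ p ≈ 0#
    char-X = λ { ℕ.zero → K.trans (fromℕ-const p ℕ.zero) char ; (suc i) → K.trans (fromℕ-const p (suc i)) K.refl }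
    E E′ : Carrier
    E  = 1# - (fromℕ 4 * X)
    E′ = 1# - (const (K.fromℕ 4) * X)
    -- Equality in K[X] is a Π-type over coefficient indices, so Agda cannot
    -- infer the implicit arguments of the congruence lemmas (here and in the
    -- chain above).
    E≈E′ : E ≈ E′
    E≈E′ = +-cong {1#} {1#} { - (fromℕ 4 * X)} { - (const (K.fromℕ 4) * X)} (refl {1#})
             (-‿cong {fromℕ 4 * X} {const (K.fromℕ 4) * X} (*-cong {fromℕ 4} {const (K.fromℕ 4)} {X} {X} (fromℕ-const 4) (refl {X})))


-- Multiplication by a unit a permutes the field, which turns
-- the product P of all elements (with 0 replaced by 1) into a^q'·P.
module FiniteFieldFermat {c ℓ} (K : Field c ℓ) (q' : ℕ) (card : HasCardinality K (suc q')) where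
  open import Data.Nat as ℕ using (ℕ; zero; suc)
  open import Data.Fin as Fin using (Fin; punchIn)
  import Data.Fin.Properties as FinP
  open import Data.Fin.Permutation using (Permutation; permutation)
  open import Data.Product using (_,_; proj₁; proj₂)
  open import Data.Empty using (⊥-elim)
  open import Relation.Nullary using (¬_; Dec; yes; no)
  open import Relation.Binary.PropositionalEquality as P using (_≡_)
  open Field K using (inv; inverseʳ; 0≉1; commutativeRing)
  open RingFacts commutativeRing
  open FieldFacts K using (mul-nonzero; inverseˡ)
  open HasCardinality card
  open import Relation.Binary.Reasoning.Setoid setoid
  import Algebra.Properties.CommutativeMonoid.Sum *-commutativeMonoid as Product
  open Product using () renaming (sum to prod)

  index : Carrier → Fin (suc q')
  index a = proj₁ (enum-surj a)

  enum-index : ∀ a → enum (index a) ≈ a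
  enum-index a = proj₂ (enum-surj a)

  -- equality in a finite field is decidable, by comparing indices
  _≟_ : ∀ a b → Dec (a ≈ b)
  a ≟ b with index a Fin.≟ index b
  ... | yes i≡j = yes (trans (sym (enum-index a)) (trans (reflexive (P.cong enum i≡j)) (enum-index b)))
  ... | no  i≢j = no (λ a≈b → i≢j (enum-inj _ _ (trans (enum-index a) (trans a≈b (sym (enum-index b))))))

  nonzeroPart : Carrier → Carrier
  nonzeroPart u with u ≟ 0#
  ... | yes _ = 1#
  ... | no  _ = u

  nonzeroPart-nonzero : ∀ u → ¬ (nonzeroPart u ≈ 0#)
  nonzeroPart-nonzero u with u ≟ 0#
  ... | yes _   = λ 1≈0 → 0≉1 (sym 1≈0)
  ... | no  u≉0 = u≉0

  prod-nonzero : ∀ n (f : Fin n → Carrier) → (∀ i → ¬ (f i ≈ 0#)) → ¬ (prod f ≈ 0#)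
  prod-nonzero zero    f f≉0 1≈0 = 0≉1 (sym 1≈0)
  prod-nonzero (suc n) f f≉0 = mul-nonzero _ _ (f≉0 Fin.zero) (prod-nonzero n (λ i → f (Fin.suc i)) (λ i → f≉0 (Fin.suc i)))

  prod-const : ∀ n (f : Fin n → Carrier) a → (∀ i → f i ≈ a) → prod f ≈ a ^ n
  prod-const zero    f a f≈a = refl
  prod-const (suc n) f a f≈a = *-cong (f≈a Fin.zero) (prod-const n (λ i → f (Fin.suc i)) a (λ i → f≈a (Fin.suc i)))

  module Unit (a : Carrier) (a≉0 : ¬ (a ≈ 0#)) where
    σ τ : Fin (suc q') → Fin (suc q')
    σ i = index (a * enum i)
    τ j = index (inv a * enum j)

    cancel : ∀ b c → b * c ≈ 1# → ∀ u → b * (c * u) ≈ u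
    cancel b c bc≈1 u = trans (sym (*-assoc _ _ _)) (trans (*-congʳ bc≈1) (*-identityˡ u))

    multiplication-permutes : Permutation (suc q') (suc q')
    multiplication-permutes = permutation σ τ
      (λ j → enum-inj _ _ (trans (enum-index _) (trans (*-congˡ (enum-index _))
                (cancel a (inv a) (inverseʳ a a≉0) (enum j)))))
      (λ i → enum-inj _ _ (trans (enum-index _) (trans (*-congˡ (enum-index _))
                (cancel (inv a) a (inverseˡ a a≉0) (enum i)))))

    factor : Fin (suc q') → Carrier
    factor i with enum i ≟ 0#
    ... | yes _ = 1#
    ... | no  _ = a

    scaling : ∀ i → nonzeroPart (enum (σ i)) ≈ factor i * nonzeroPart (enum i)
    scaling i with enum i ≟ 0# | enum (σ i) ≟ 0#
    ... | yes _    | yes _    = sym (*-identityˡ _)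
    ... | yes u≈0  | no  au≉0 = ⊥-elim (au≉0 (trans (enum-index _) (trans (*-congˡ u≈0) (zeroʳ a))))
    ... | no  u≉0  | yes au≈0 = ⊥-elim (mul-nonzero a (enum i) a≉0 u≉0 (trans (sym (enum-index _)) au≈0))
    ... | no  _    | no  _    = enum-index _

    -- exactly one index (that of 0) has factor 1, all others have factor a
    factor-product : prod factor ≈ a ^ q'
    factor-product = trans (Product.sum-remove {i = index 0#} factor)
                           (trans (*-cong factor-at-0 (prod-const q' _ a factor-elsewhere)) (*-identityˡ _))
      where
      factor-at-0 : factor (index 0#) ≈ 1#
      factor-at-0 with enum (index 0#) ≟ 0#
      ... | yes _   = refl
      ... | no  ≉0 = ⊥-elim (≉0 (enum-index 0#))
      factor-elsewhere : ∀ j → factor (punchIn (index 0#) j) ≈ a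
      factor-elsewhere j with enum (punchIn (index 0#) j) ≟ 0#
      ... | yes ≈0 = ⊥-elim (FinP.punchInᵢ≢i (index 0#) j (enum-inj _ _ (trans ≈0 (sym (enum-index 0#)))))
      ... | no  _  = refl

    P : Carrier
    P = prod (λ i → nonzeroPart (enum i))

    P-invariant : P ≈ a ^ q' * P
    P-invariant = begin
      P                                           ≈⟨ Product.sum-permute (λ i → nonzeroPart (enum i)) multiplication-permutes ⟩
      prod (λ i → nonzeroPart (enum (σ i)))       ≈⟨ Product.sum-cong-≋ scaling ⟩
      prod (λ i → factor i * nonzeroPart (enum i)) ≈⟨ Product.∑-distrib-+ factor (λ i → nonzeroPart (enum i)) ⟩
      prod factor * P                             ≈⟨ *-congʳ factor-product ⟩
      a ^ q' * P                                  ∎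

    unit-power : a ^ q' ≈ 1#
    unit-power = begin
      a ^ q'                 ≈⟨ sym (*-identityʳ _) ⟩
      a ^ q' * 1#            ≈⟨ *-congˡ (sym (inverseʳ P P≉0)) ⟩
      a ^ q' * (P * inv P)   ≈⟨ sym (*-assoc _ _ _) ⟩
      (a ^ q' * P) * inv P   ≈⟨ *-congʳ (sym P-invariant) ⟩
      P * inv P              ≈⟨ inverseʳ P P≉0 ⟩
      1#                     ∎
      where P≉0 = prod-nonzero (suc q') (λ i → nonzeroPart (enum i)) (λ i → nonzeroPart-nonzero (enum i))

  fermat : ∀ a → a ^ suc q' ≈ a
  fermat a with a ≟ 0#
  ... | yes a≈0 = trans (*-congʳ a≈0) (trans (zeroˡ _) (sym a≈0))
  ... | no  a≉0 = trans (*-congˡ (Unit.unit-power a a≉0)) (*-identityʳ a)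


-- In Q = F_q[t]/(t² - t + x₀) the q-power map Φ is a ring endomorphism
-- fixing F_q, so Φ(t) is again a root of T² - T + x₀.  When the
-- discriminant 1 - 4x₀ is nonzero the only roots are t and 1 - t, hence
-- Φ² fixes t and 1 - t:  t^(q²) = t  and  (1-t)^(q²) = 1 - t.
module FrobeniusOfRoot {c ℓ} (K : Field c ℓ) (p : ℕ) (p-prime : Prime p) (p-odd : p % 2 ≡ 1)
                       (char : HasCharacteristic K p) (q' m : ℕ) (q≡p^m : suc q' ≡ p Data.Nat.^ m)
                       (card : HasCardinality K (suc q'))
                       (x₀ : Field.Carrier K) (x₀≉¼ : ¬ (Field._≈_ K x₀ (Field.inv K (RawOps.fromℕ (Field.rawRing K) 4))))
                       where
  open import Data.Nat as ℕ using ()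
  import Data.Nat.Properties as ℕP
  open import Data.Integer using (+_)
  open import Data.Sum using (_⊎_; inj₁; inj₂)
  open import Data.Empty using (⊥; ⊥-elim)
  open import Relation.Nullary using (yes; no)
  open import Relation.Binary.PropositionalEquality as P using ()
  open Field K using (inv; commutativeRing)
  open RingFacts commutativeRing
  open FieldFacts K using (cancel-nonzero; divide; pow-nonzero)
  open FieldFacts.OddCharacteristic K p p-odd char using (four-nonzero)
  open FiniteFieldFermat K q' card using (_≟_; fermat)
  open QuadraticAlgebra commutativeRing x₀
  open Frobenius.Characteristic quadraticRing p p-prime (A.trans (ι-fromℕ p) ⟨ char , refl ⟩)
  open Solver using (solve; _:=_; _:+_; _:*_; :-_; con)

  q : ℕ
  q = suc q'

  -- the q-power map; q = p^m makes it an iterated Frobenius, hence additive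
  Φ : Q → Q
  Φ u = u ^Q q

  Φ-cong : ∀ {u v} → u ≈Q v → Φ u ≈Q Φ v
  Φ-cong = A.^-congˡ q

  Φ-- : ∀ u v → Φ (u -Q v) ≈Q Φ u -Q Φ v
  Φ-- u v = P.subst (λ e → (u -Q v) ^Q e ≈Q (u ^Q e) -Q (v ^Q e)) (P.sym q≡p^m) (frobenius-pow-- m u v)

  Φ-* : ∀ u v → Φ (u *Q v) ≈Q Φ u *Q Φ v
  Φ-* u v = A.^-distrib-* u v q

  -- Fermat: Φ fixes the base field
  Φ-ι : ∀ a → Φ (ι a) ≈Q ι a
  Φ-ι a = A.trans (ι-^ a q) ⟨ fermat a , refl ⟩

  discriminant-nonzero : ¬ (1# - (fromℕ 4 * x₀) ≈ 0#)
  discriminant-nonzero D≈0 = x₀≉¼ (trans (divide (fromℕ 4) x₀ 1# four-nonzero (begin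
    fromℕ 4 * x₀                      ≈⟨ solve 1 (λ a → a := con (+ 1) :+ :- (con (+ 1) :+ :- a)) refl (fromℕ 4 * x₀) ⟩
    1# - (1# - (fromℕ 4 * x₀))        ≈⟨ +-congˡ (-‿cong D≈0) ⟩
    1# - 0#                           ≈⟨ trans (+-congˡ -0#≈0#) (+-identityʳ 1#) ⟩
    1#                                ∎)) (*-identityˡ _))
    where open import Relation.Binary.Reasoning.Setoid setoid

  w : Q
  w = Φ t

  a b : Carrier
  a = re w
  b = im w

  t-root : t *Q t ≈Q t -Q ι x₀
  t-root = ⟨ solve 1 (λ X → con (+ 0) :* con (+ 0) :+ :- (X :* (con (+ 1) :* con (+ 1))) := con (+ 0) :+ :- X) refl x₀
           , solve 0 ((con (+ 0) :* con (+ 1) :+ con (+ 1) :* con (+ 0)) :+ con (+ 1) :* con (+ 1)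
                        := con (+ 1) :+ :- con (+ 0)) refl ⟩

  w-root : w *Q w ≈Q w -Q ι x₀
  w-root = A.trans (A.sym (Φ-* t t)) (A.trans (Φ-cong t-root)
             (A.trans (Φ-- t (ι x₀)) (A.+-congˡ (A.-‿cong (Φ-ι x₀)))))

  w-re : a * a + - (x₀ * (b * b)) ≈ a + - x₀
  w-re = re≈ w-root

  w-im : (a * b + b * a) + b * b ≈ b + - 0#
  w-im = im≈ w-root

  c′ : Carrier
  c′ = 1# - (a + a)

  -- If b = 0 then w ∈ F_q, and v = t - w satisfies Φ(v) = 0 although
  -- v² = (1 - 2a)·v with 1 - 2a ≠ 0, so v^q ≠ 0: impossible.
  module NotInBaseField (b≈0 : b ≈ 0#) where
    open import Relation.Binary.Reasoning.Setoid setoid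

    a-root : (a * a + - a) + x₀ ≈ 0#
    a-root = begin
      (a * a + - a) + x₀
        ≈⟨ solve 3 (λ a b X → (a :* a :+ :- a) :+ X := ((a :* a :+ :- (X :* (b :* b))) :+ :- (a :+ :- X)) :+ X :* (b :* b))
                 refl a b x₀ ⟩
      ((a * a + - (x₀ * (b * b))) + - (a + - x₀)) + x₀ * (b * b)
        ≈⟨ +-cong (trans (+-congʳ w-re) (-‿inverseʳ _)) (*-congˡ (*-cong b≈0 b≈0)) ⟩
      0# + x₀ * (0# * 0#)
        ≈⟨ solve 1 (λ X → con (+ 0) :+ X :* (con (+ 0) :* con (+ 0)) := con (+ 0)) refl x₀ ⟩
      0# ∎

    c′≉0 : ¬ (c′ ≈ 0#)
    c′≉0 c′≈0 = discriminant-nonzero (begin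
      1# - (fromℕ 4 * x₀)
        ≈⟨ solve 3 (λ a X A → con (+ 1) :+ :- (con (+ 4) :* X)
                 := ((con (+ 1) :+ :- (a :+ a)) :* (con (+ 1) :+ :- (a :+ a))) :+ :- (con (+ 4) :* ((a :* a :+ :- a) :+ X)))
                 refl a x₀ ((a * a + - a) + x₀) ⟩
      (c′ * c′) - (fromℕ 4 * ((a * a + - a) + x₀))
        ≈⟨ +-cong (*-congʳ c′≈0) (-‿cong (*-congˡ a-root)) ⟩
      (0# * c′) - (fromℕ 4 * 0#)
        ≈⟨ solve 1 (λ c → con (+ 0) :* c :+ :- (con (+ 4) :* con (+ 0)) := con (+ 0)) refl c′ ⟩
      0# ∎)

    v : Q
    v = t -Q ι a

    Φv≈0 : Φ v ≈Q 0Q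
    Φv≈0 = A.trans (Φ-- t (ι a)) (A.trans (A.+-congˡ (A.-‿cong (Φ-ι a)))
             ⟨ -‿inverseʳ a , trans (+-cong b≈0 -0#≈0#) (+-identityʳ 0#) ⟩)

    v² : v *Q v ≈Q ι c′ *Q v
    v² = ⟨ begin
           (0# + - a) * (0# + - a) + - (x₀ * ((1# + - 0#) * (1# + - 0#)))
             ≈⟨ solve 2 (λ a X → (con (+ 0) :+ :- a) :* (con (+ 0) :+ :- a) :+ :- (X :* ((con (+ 1) :+ :- con (+ 0)) :* (con (+ 1) :+ :- con (+ 0))))
                  := ((con (+ 1) :+ :- (a :+ a)) :* (con (+ 0) :+ :- a) :+ :- (X :* (con (+ 0) :* (con (+ 1) :+ :- con (+ 0)))))
                       :+ :- ((a :* a :+ :- a) :+ X)) refl a x₀ ⟩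
           (c′ * (0# + - a) + - (x₀ * (0# * (1# + - 0#)))) + - ((a * a + - a) + x₀)
             ≈⟨ +-congˡ (trans (-‿cong a-root) -0#≈0#) ⟩
           (c′ * (0# + - a) + - (x₀ * (0# * (1# + - 0#)))) + 0#
             ≈⟨ +-identityʳ _ ⟩
           c′ * (0# + - a) + - (x₀ * (0# * (1# + - 0#))) ∎
         , solve 1 (λ a → ((con (+ 0) :+ :- a) :* (con (+ 1) :+ :- con (+ 0)) :+ (con (+ 1) :+ :- con (+ 0)) :* (con (+ 0) :+ :- a))
                            :+ (con (+ 1) :+ :- con (+ 0)) :* (con (+ 1) :+ :- con (+ 0))
                          := ((con (+ 1) :+ :- (a :+ a)) :* (con (+ 1) :+ :- con (+ 0)) :+ con (+ 0) :* (con (+ 0) :+ :- a))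
                            :+ con (+ 0) :* (con (+ 1) :+ :- con (+ 0))) refl a ⟩

    absurd : ⊥
    absurd = pow-nonzero c′ q' c′≉0 (begin
      c′ ^ q'                         ≈⟨ solve 2 (λ C a → C := (C :* (con (+ 1) :+ :- con (+ 0)) :+ con (+ 0) :* (con (+ 0) :+ :- a))
                                                              :+ con (+ 0) :* (con (+ 1) :+ :- con (+ 0))) refl (c′ ^ q') a ⟩
      im (ι (c′ ^ q') *Q v)           ≈⟨ sym (im≈ (A.trans (A.^-of-scaling-square v (ι c′) v² q') (A.*-congʳ (ι-^ c′ q')))) ⟩
      im (Φ v)                        ≈⟨ im≈ Φv≈0 ⟩
      0#                              ∎)

  -- If b ≠ 0 then b = 1 - 2a, and then a(a - 1)(1 - 4x₀) = 0 forces a ∈ {0, 1}.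
  module OutsideBaseField (b≉0 : ¬ (b ≈ 0#)) where
    open import Relation.Binary.Reasoning.Setoid setoid

    b≈c′ : b ≈ c′
    b≈c′ = begin
      b                               ≈⟨ solve 2 (λ a b → b := (con (+ 1) :+ :- (a :+ a)) :+ ((a :+ a) :+ b :+ :- con (+ 1))) refl a b ⟩
      c′ + ((a + a) + b + - 1#)       ≈⟨ +-congˡ (cancel-nonzero b _ b≉0 (begin
          b * ((a + a) + b + - 1#)
            ≈⟨ solve 2 (λ a b → b :* ((a :+ a) :+ b :+ :- con (+ 1)) := ((a :* b :+ b :* a) :+ b :* b) :+ :- (b :+ :- con (+ 0))) refl a b ⟩
          ((a * b + b * a) + b * b) - (b + - 0#)
            ≈⟨ trans (+-congʳ w-im) (-‿inverseʳ _) ⟩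
          0# ∎)) ⟩
      c′ + 0#                         ≈⟨ +-identityʳ c′ ⟩
      c′                              ∎

    a-idempotent : a * (a + - 1#) ≈ 0#
    a-idempotent = begin
      a * (a + - 1#)  ≈⟨ solve 1 (λ a → a :* (a :+ :- con (+ 1)) := a :* a :+ :- a) refl a ⟩
      a * a + - a     ≈⟨ cancel-nonzero _ (a * a + - a) discriminant-nonzero (begin
          (1# - (fromℕ 4 * x₀)) * (a * a + - a)
            ≈⟨ solve 2 (λ a X → (con (+ 1) :+ :- (con (+ 4) :* X)) :* (a :* a :+ :- a)
                  := (a :* a :+ :- (X :* ((con (+ 1) :+ :- (a :+ a)) :* (con (+ 1) :+ :- (a :+ a))))) :+ :- (a :+ :- X)) refl a x₀ ⟩
          (a * a + - (x₀ * (c′ * c′))) - (a + - x₀)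
            ≈⟨ +-congʳ (trans (+-congˡ (-‿cong (*-congˡ (sym (*-cong b≈c′ b≈c′))))) w-re) ⟩
          (a + - x₀) - (a + - x₀)
            ≈⟨ -‿inverseʳ _ ⟩
          0# ∎) ⟩
      0#              ∎

    a≈0⇒w≈t : a ≈ 0# → w ≈Q t
    a≈0⇒w≈t a≈0 = ⟨ a≈0 , trans b≈c′ (trans (+-congˡ (-‿cong (+-cong a≈0 a≈0)))
                      (solve 0 (con (+ 1) :+ :- (con (+ 0) :+ con (+ 0)) := con (+ 1)) refl)) ⟩

    a≉0⇒w≈1-t : ¬ (a ≈ 0#) → w ≈Q 1Q -Q t
    a≉0⇒w≈1-t a≉0 = ⟨ trans a≈1 (sym (trans (+-congˡ -0#≈0#) (+-identityʳ 1#)))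
                     , trans b≈c′ (trans (+-congˡ (-‿cong (+-cong a≈1 a≈1)))
                         (solve 0 (con (+ 1) :+ :- (con (+ 1) :+ con (+ 1)) := con (+ 0) :+ :- con (+ 1)) refl)) ⟩
      where
      a≈1 : a ≈ 1#
      a≈1 = begin
        a                ≈⟨ solve 1 (λ a → a := (a :+ :- con (+ 1)) :+ con (+ 1)) refl a ⟩
        (a + - 1#) + 1#  ≈⟨ +-congʳ (cancel-nonzero a _ a≉0 a-idempotent) ⟩
        0# + 1#          ≈⟨ +-identityˡ 1# ⟩
        1#               ∎

  Φt-is-root : (Φ t ≈Q t) ⊎ (Φ t ≈Q 1Q -Q t)
  Φt-is-root with b ≟ 0#
  ... | yes b≈0 = ⊥-elim (NotInBaseField.absurd b≈0)
  ... | no  b≉0 with a ≟ 0#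
  ...   | yes a≈0 = inj₁ (OutsideBaseField.a≈0⇒w≈t b≉0 a≈0)
  ...   | no  a≉0 = inj₂ (OutsideBaseField.a≉0⇒w≈1-t b≉0 a≉0)

  Φ-complement : ∀ u → Φ (1Q -Q u) ≈Q 1Q -Q Φ u
  Φ-complement u = A.trans (Φ-- 1Q u) (A.+-congʳ (Φ-ι 1#))

  ΦΦt : Φ (Φ t) ≈Q t
  ΦΦt with Φt-is-root
  ... | inj₁ Φt≈t   = A.trans (Φ-cong Φt≈t) Φt≈t
  ... | inj₂ Φt≈1-t = A.trans (Φ-cong Φt≈1-t) (A.trans (Φ-complement t)
                        (A.trans (A.+-congˡ (A.-‿cong Φt≈1-t)) (A.complement-involutive t)))

  ΦΦ[1-t] : Φ (Φ (1Q -Q t)) ≈Q 1Q -Q t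
  ΦΦ[1-t] = A.trans (Φ-cong (Φ-complement t)) (A.trans (Φ-complement (Φ t)) (A.+-congˡ (A.-‿cong ΦΦt)))

  q²-power : ∀ u → u ^Q suc (q ℕ.^ 2 ℕ.∸ 1) ≈Q Φ (Φ u)
  q²-power u = A.trans (A.reflexive (P.cong (u ^Q_) (P.cong (q ℕ.*_) (ℕP.*-identityʳ q)))) (A.^-* u q q)


module Periodicity {c ℓ} (K : Field c ℓ) (p : ℕ) (p-prime : Prime p) (p-odd : p % 2 ≡ 1)
                   (char : HasCharacteristic K p) (q' m : ℕ) (q≡p^m : suc q' ≡ p Data.Nat.^ m)
                   (card : HasCardinality K (suc q'))
                   (x₀ : Field.Carrier K) (x₀≉¼ : ¬ (Field._≈_ K x₀ (Field.inv K (RawOps.fromℕ (Field.rawRing K) 4))))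
                   where
  open import Data.Nat as ℕ using (_∸_; _≤_)
  import Data.Nat.Properties as ℕP
  open import Data.Nat.Divisibility using (_∣_; divides)
  open import Relation.Binary.PropositionalEquality as P using ()
  open Field K using (commutativeRing)
  open RingFacts commutativeRing
  open Lucas commutativeRing using (U; module Expansion)
  open QuadraticAlgebra commutativeRing x₀
  open FrobeniusOfRoot K p p-prime p-odd char q' m q≡p^m card x₀ x₀≉¼ using (q; q²-power; ΦΦt; ΦΦ[1-t])

  T : ℕ
  T = q ℕ.^ 2 ∸ 1

  U-periodic : ∀ n j → U x₀ (suc n ℕ.+ j ℕ.* T) ≈ U x₀ (suc n)
  U-periodic n j = δ-cancel (begin
    δ *Q ι (U x₀ (suc n ℕ.+ j ℕ.* T))                            ≈⟨ A.sym (root-difference (suc n ℕ.+ j ℕ.* T)) ⟩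
    (t ^Q (suc n ℕ.+ j ℕ.* T)) -Q ((1Q -Q t) ^Q (suc n ℕ.+ j ℕ.* T))
      ≈⟨ A.+-cong (A.^-periodic t T (A.trans (q²-power t) ΦΦt) n j)
                  (A.-‿cong (A.^-periodic (1Q -Q t) T (A.trans (q²-power (1Q -Q t)) ΦΦ[1-t]) n j)) ⟩
    (t ^Q suc n) -Q ((1Q -Q t) ^Q suc n)                         ≈⟨ root-difference (suc n) ⟩
    δ *Q ι (U x₀ (suc n))                                        ∎)
    where open import Relation.Binary.Reasoning.Setoid A.setoid

  F-congruent : ∀ s r → 1 ≤ r → r ≤ s → T ∣ (s ∸ r) → F s 1# x₀ ≈ F r 1# x₀
  F-congruent s (suc n) _ r≤s (divides j s-r≡jT) = begin
    F s 1# x₀                        ≡⟨ P.cong (λ e → F e 1# x₀) s≡ ⟩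
    F (suc n ℕ.+ j ℕ.* T) 1# x₀      ≈⟨ Expansion.F≈U x₀ (n ℕ.+ j ℕ.* T) ⟩
    U x₀ (suc n ℕ.+ j ℕ.* T)         ≈⟨ U-periodic n j ⟩
    U x₀ (suc n)                     ≈⟨ sym (Expansion.F≈U x₀ n) ⟩
    F (suc n) 1# x₀                  ∎
    where
    open import Relation.Binary.Reasoning.Setoid setoid
    s≡ : s P.≡ suc n ℕ.+ j ℕ.* T
    s≡ = P.trans (P.sym (ℕP.m+[n∸m]≡n r≤s)) (P.cong (suc n ℕ.+_) s-r≡jT)



module Part3 where
  open import Level using (0ℓ)
  open import Data.Nat as ℕ using (suc; _∸_; _%_; _≤_)
  import Data.Nat.Properties as ℕP
  open import Data.Nat.Divisibility using () renaming (_∣_ to _∣ℕ_)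
  open import Data.Nat.Primality using (Prime)
  open import Data.Integer as ℤ using (+_)
  import Data.Integer.Properties as ℤP
  open import Data.Integer.Divisibility using () renaming (_∣_ to _∣ℤ_)
  open import Data.Sum using (inj₁; inj₂)
  open import Relation.Binary.PropositionalEquality as P using (_≡_)

  divides-distance : ∀ T n₁ n₂ → (+ T) ∣ℤ ((+ n₁) ℤ.- (+ n₂)) → ∀ {a b} →
                     ℤ.∣ a ℤ.⊖ b ∣ ≡ ℤ.∣ n₁ ℤ.⊖ n₂ ∣ → b ≤ a → T ∣ℕ (a ∸ b)
  divides-distance T n₁ n₂ T∣n₁-n₂ {a} {b} same-distance b≤a =
    P.subst (T ∣ℕ_) (P.trans (P.cong ℤ.∣_∣ (ℤP.m-n≡m⊖n n₁ n₂))
                    (P.trans (P.sym same-distance) (P.trans (ℤP.∣m⊖n∣≡∣n⊖m∣ a b) (ℤP.∣⊖∣-≤ b≤a)))) T∣n₁-n₂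

  part3 : ∀ (K : Field 0ℓ 0ℓ) p → Prime p → p % 2 ≡ 1 → HasCharacteristic K p →
          ∀ q' m → suc q' ≡ p ℕ.^ m → HasCardinality K (suc q') → Claim3 (suc q') K
  part3 K p p-prime p-odd char q' m q≡p^m card n₁ n₂ 1≤n₁ 1≤n₂ T∣n₁-n₂ x₀ x₀≉¼ with ℕP.≤-total n₂ n₁
  ... | inj₁ n₂≤n₁ = F-congruent n₁ n₂ 1≤n₂ n₂≤n₁ (divides-distance T n₁ n₂ T∣n₁-n₂ P.refl n₂≤n₁)
    where open Periodicity K p p-prime p-odd char q' m q≡p^m card x₀ x₀≉¼
  ... | inj₂ n₁≤n₂ = Field.sym K (F-congruent n₂ n₁ 1≤n₁ n₁≤n₂
                       (divides-distance T n₁ n₂ T∣n₁-n₂ (ℤP.∣m⊖n∣≡∣n⊖m∣ n₂ n₁) n₁≤n₂))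
    where open Periodicity K p p-prime p-odd char q' m q≡p^m card x₀ x₀≉¼


open import Level using (0ℓ)
open import Data.Nat using (zero; _≤_; _^_)
open import Data.Nat.GCD using (gcd)
open import Data.Product using (_×_; ∃; _,_; proj₁)

-- The three parts hold for all n, k ≥ 1; part (2) does not need gcd(n, k) = 1.
-- A field with q elements has q ≥ 1 (it contains 0).
theorem2p3 : (p : ℕ) → Prime p → p % 2 ≡ 1 →
    (q : ℕ) → (∃ λ m → 1 ≤ m × q ≡ p ^ m) →
    (Fq : Field 0ℓ 0ℓ) → HasCharacteristic Fq p → HasCardinality Fq q →
    (n k : ℕ) → 1 ≤ n → 1 ≤ k →
    Claim1 p n × (gcd n k ≡ 1 → Claim2 p n k Fq) × Claim3 q Fq
theorem2p3 p p-prime p-odd q (m , _ , q≡p^m) Fq char card n k 1≤n _ =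
  Part1.part1 p n p-odd 1≤n , (λ _ → Part2.part2 Fq p p-prime p-odd char n k 1≤n) , part3 q q≡p^m card
  where
  part3 : ∀ q → q ≡ p ^ m → HasCardinality Fq q → Claim3 q Fq
  part3 zero    _     card with proj₁ (HasCardinality.enum-surj card (Field.0# Fq))
  ... | ()
  part3 (suc q') q≡p^m card = Part3.part3 Fq p p-prime p-odd char q' m q≡p^m card
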